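{- There exists a real constant $C_0$ such that for every positive integer $a$ with $l(a)\ge 1$, $$\|\mu_a\|_{l^2(\mathbb{Z})}\le C_0\, l(a)^{ -1/4}.$$
   Context: For $x\in\mathbb{N}$, $s_2(x)$ is the number of digits $1$ in the binary expansion of $x$. For $a\in\mathbb{N}$ and $d\in\mathbb{Z}$, $\mu_a(d)=\lim_{N\to\infty}\frac1N\#\{x\in\mathbb{N}: x\le N,\ s_2(x+a)-s_2(x)=d\}$ (this limit exists), a probability measure on $\mathbb{Z}$. Writing $a=\sum_{k=0}^N a_k2^k$ with $a_N=1$, $\underline a$ denotes the word $a_0a_1\cdots a_N$ (least significant digit first), and $l(a)$ is the number of occurrences of the subword $01$ in $\underline a$, i.e. the number of indices $i$ with $a_i=0$, $a_{i+1}=1$. -}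

module Defs where

open import Data.Nat as ℕ using (ℕ; zero; suc; _%_; _/_)
open import Data.Integer as ℤ using (ℤ; +_)
open import Data.Rational as ℚ using (ℚ; 0ℚ; ∣_∣)
open import Data.List using (List; upTo; map; foldr)
open import Data.Product using (∃; _×_)
open import Relation.Nullary.Decidable using (⌊_⌋)
open import Data.Bool using (if_then_else_)

-- s₂ with fuel: fuel n suffices since n halves each step.
s₂-fuel : ℕ → ℕ → ℕ
s₂-fuel zero    n = 0
s₂-fuel (suc f) n = n % 2 ℕ.+ s₂-fuel f (n / 2)

s₂ : ℕ → ℕ
s₂ n = s₂-fuel n n

-- number of indices i with a_i = 0 and a_{i+1} = 1 (binary digits, LSB first)
l-fuel : ℕ → ℕ → ℕ
l-fuel zero    n = 0
l-fuel (suc f) n =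
  (if ⌊ n % 2 ℕ.≟ 0 ⌋ then (if ⌊ (n / 2) % 2 ℕ.≟ 1 ⌋ then 1 else 0) else 0)
  ℕ.+ l-fuel f (n / 2)

l : ℕ → ℕ
l a = l-fuel a a

count : ℕ → ℤ → ℕ → ℕ
count a d N = foldr ℕ._+_ 0
  (map (λ x → if ⌊ (+ s₂ (x ℕ.+ a)) ℤ.- (+ s₂ x) ℤ.≟ d ⌋ then 1 else 0)
       (upTo (suc N)))

-- (1/N) #{x ≤ N : ...}, indexed by n with N = n + 1
freq : ℕ → ℤ → ℕ → ℚ
freq a d n = (+ count a d (suc n)) ℚ./ suc n

IsLimit : (ℕ → ℚ) → ℚ → Set
IsLimit s r = ∀ (ε : ℚ) → 0ℚ ℚ.< ε → ∃ λ N₀ → ∀ n → N₀ ℕ.≤ n → ∣ s n ℚ.- r ∣ ℚ.≤ ε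

IsMu : ℕ → (ℤ → ℚ) → Set
IsMu a m = ∀ d → IsLimit (freq a d) (m d)

-- partial sum Σ_{d=-M}^{M} m(d)²
sqSum : (ℤ → ℚ) → ℕ → ℚ
sqSum m M = foldr ℚ._+_ 0ℚ
  (map (λ k → m ((+ k) ℤ.- (+ M)) ℚ.* m ((+ k) ℤ.- (+ M)))
       (upTo (suc (M ℕ.+ M))))

module Submission where

-- Smooth the count #{x < M : D_w(x) = e} by convolving it with k fair coin flips
-- (`smoothedCount`).  Reading the binary digits of a from the bottom, a digit equal to the
-- incoming carry just doubles the counts, while a "mixed" pair of digits (the lower one
-- different from the carry) splits them into three counts that Pascal's rule recombines.
-- This gains a factor H(m+1, k)/(4 H(m, k)) for the potential H(0, k) = C(k, ⌈k/2⌉),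
-- H(m+1, k) = H(m, k+1) + 2 H(m, k) (`digits-gain`).  Cauchy–Schwarz over lattice paths and
-- the central binomial bound C(k, ⌈k/2⌉)² (k+1) ≤ 4^k give H(m, 0)² (m+1) ≤ 8·16^m
-- (`potential-bound`), and each mixed pair accounts for at most two 01 patterns, so
-- l(a) ≤ 2m + 1.  Thus every point mass of μ_a is at most β = H(m, 0)/4^m, the masses add up
-- to at most 1, and ‖μ_a‖₂⁴ l(a) ≤ β² (2m + 2) ≤ 16.

open import Defs
open import Algebra.Properties.CommutativeSemigroup using (interchange)
open import Data.Bool using (Bool; true; false; if_then_else_)
open import Data.Empty using (⊥)
open import Data.Integer as ℤ using (ℤ; +_; -[1+_])
import Data.Integer.Properties as ℤₚ
import Data.Integer.Tactic.RingSolver as ℤ-Solver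
open import Data.List using (List; []; _∷_; length; foldr; map; upTo; applyUpTo)
open import Data.List.Properties using (map-upTo)
open import Data.Nat
open import Data.Nat.Properties
open import Data.Nat.DivMod
open import Data.Nat.Divisibility using (divides)
open import Data.Nat.Tactic.RingSolver using (solve-∀)
open import Data.Product using (∃; _×_; _,_; proj₁; proj₂)
open import Data.Rational as ℚ using (ℚ; 0ℚ; mkℚ)
import Data.Rational.Properties as ℚₚ
import Data.Rational.Unnormalised as ℚᵘ
import Data.Rational.Unnormalised.Properties as ℚᵘₚ
open import Data.Rational.Solver using (module +-*-Solver)
open import Data.Sum using (_⊎_; inj₁; inj₂)
open import Relation.Binary.PropositionalEquality
open import Relation.Nullary using (yes; no; contradiction)
open import Relation.Nullary.Decidable using (⌊_⌋)

open +-*-Solver using (solve; _:+_; _:-_; :-_; _:=_)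

+-interchange : ∀ a b c d → (a + b) + (c + d) ≡ (a + c) + (b + d)
+-interchange = interchange +-commutativeSemigroup


sumBelow : (ℕ → ℕ) → ℕ → ℕ
sumBelow f zero    = 0
sumBelow f (suc n) = f 0 + sumBelow (λ x → f (suc x)) n

sumBelow-cong : ∀ {f g : ℕ → ℕ} n → (∀ x → f x ≡ g x) → sumBelow f n ≡ sumBelow g n
sumBelow-cong zero    f≡g = refl
sumBelow-cong (suc n) f≡g = cong₂ _+_ (f≡g 0) (sumBelow-cong n (λ x → f≡g (suc x)))

sumBelow-+ : ∀ (f g : ℕ → ℕ) n → sumBelow (λ x → f x + g x) n ≡ sumBelow f n + sumBelow g n
sumBelow-+ f g zero    = refl
sumBelow-+ f g (suc n) =
  trans (cong (_+_ (f 0 + g 0)) (sumBelow-+ (λ x → f (suc x)) (λ x → g (suc x)) n))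
        (+-interchange (f 0) (g 0) _ _)

sumBelow-monoˡ : ∀ (f : ℕ → ℕ) {n n′} → n ≤ n′ → sumBelow f n ≤ sumBelow f n′
sumBelow-monoˡ f {zero}              _         = z≤n
sumBelow-monoˡ f {suc n} {suc n′} (s≤s n≤n′) = +-monoʳ-≤ (f 0) (sumBelow-monoˡ (λ x → f (suc x)) n≤n′)

sumBelow-≤-const : ∀ (f : ℕ → ℕ) c n → (∀ x → f x ≤ c) → sumBelow f n ≤ n * c
sumBelow-≤-const f c zero    f≤c = z≤n
sumBelow-≤-const f c (suc n) f≤c =
  +-mono-≤ (f≤c 0) (sumBelow-≤-const (λ x → f (suc x)) c n (λ x → f≤c (suc x)))

term≤sumBelow : ∀ (f : ℕ → ℕ) n k → k < n → f k ≤ sumBelow f n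
term≤sumBelow f (suc n) zero    _         = m≤m+n (f 0) _
term≤sumBelow f (suc n) (suc k) (s≤s k<n) =
  ≤-trans (term≤sumBelow (λ x → f (suc x)) n k k<n) (m≤n+m _ (f 0))

sumBelow-pairs : ∀ (f : ℕ → ℕ) n → sumBelow f (n * 2) ≡ sumBelow (λ y → f (y * 2) + f (suc (y * 2))) n
sumBelow-pairs f zero    = refl
sumBelow-pairs f (suc n) =
  trans (cong (λ s → f 0 + (f 1 + s)) (sumBelow-pairs (λ x → f (suc (suc x))) n))
        (sym (+-assoc (f 0) (f 1) _))

sumBelow-zero : ∀ {f : ℕ → ℕ} n → (∀ x → f x ≡ 0) → sumBelow f n ≡ 0
sumBelow-zero zero    f≡0 = refl
sumBelow-zero (suc n) f≡0 = cong₂ _+_ (f≡0 0) (sumBelow-zero n (λ x → f≡0 (suc x)))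

sumBelow-swap : ∀ (G : ℕ → ℕ → ℕ) K X →
  sumBelow (λ k → sumBelow (G k) X) K ≡ sumBelow (λ x → sumBelow (λ k → G k x) K) X
sumBelow-swap G zero    X = sym (sumBelow-zero X (λ _ → refl))
sumBelow-swap G (suc K) X =
  trans (cong (_+_ (sumBelow (G 0) X)) (sumBelow-swap (λ k → G (suc k)) K X))
        (sym (sumBelow-+ (G 0) (λ x → sumBelow (λ k → G (suc k) x) K) X))

binom : ℕ → ℕ → ℕ
binom zero    zero    = 1
binom zero    (suc j) = 0
binom (suc k) zero    = 1
binom (suc k) (suc j) = binom k j + binom k (suc j)

binom-zero : ∀ k → binom k 0 ≡ 1
binom-zero zero    = refl
binom-zero (suc k) = refl

binom-absorb : ∀ k j → suc j * binom (suc k) (suc j) ≡ suc k * binom k j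
binom-absorb zero    zero    = refl
binom-absorb zero    (suc j) = *-zeroʳ (suc (suc j))
binom-absorb (suc k) zero    = begin
  1 * (1 + binom (suc k) 1)   ≡⟨ *-identityˡ _ ⟩
  1 + binom (suc k) 1         ≡⟨ cong (_+_ 1) (trans (sym (*-identityˡ _)) (binom-absorb k 0)) ⟩
  1 + suc k * binom k 0       ≡⟨ cong (λ c → 1 + suc k * c) (binom-zero k) ⟩
  1 + suc k * 1               ≡⟨ cong suc (*-identityʳ (suc k)) ⟩
  suc (suc k)                 ≡⟨ *-identityʳ (suc (suc k)) ⟨
  suc (suc k) * 1             ∎
  where open ≡-Reasoning
binom-absorb (suc k) (suc j) = begin
  suc (suc j) * (b₁ + b₂)                       ≡⟨ split (suc j) b₁ b₂ ⟩
  (suc j * b₁ + b₁) + suc (suc j) * b₂          ≡⟨ cong₂ (λ u v → (u + b₁) + v) (binom-absorb k j) (binom-absorb k (suc j)) ⟩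
  (suc k * binom k j + b₁) + suc k * binom k (suc j)
                                                ≡⟨ merge (suc k) (binom k j) (binom k (suc j)) ⟩
  suc (suc k) * (binom k j + binom k (suc j))   ∎
  where
  open ≡-Reasoning
  b₁ = binom (suc k) (suc j)
  b₂ = binom (suc k) (suc (suc j))
  split : ∀ J x y → suc J * (x + y) ≡ (J * x + x) + suc J * y
  split = solve-∀
  merge : ∀ K x y → (K * x + (x + y)) + K * y ≡ suc K * (x + y)
  merge = solve-∀

binom-ratio : ∀ k j → suc j * binom k (suc j) + j * binom k j ≡ k * binom k j
binom-ratio zero    zero    = refl
binom-ratio zero    (suc j) = cong₂ _+_ (*-zeroʳ (suc (suc j))) (*-zeroʳ (suc j))
binom-ratio (suc k) zero    =
  trans (+-identityʳ _) (trans (binom-absorb k 0) (cong (suc k *_) (binom-zero k)))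
binom-ratio (suc k) (suc j) = begin
  suc (suc j) * binom (suc k) (suc (suc j)) + suc j * binom (suc k) (suc j)
    ≡⟨ cong₂ _+_ (binom-absorb k (suc j)) (binom-absorb k j) ⟩
  suc k * binom k (suc j) + suc k * binom k j
    ≡⟨ sym (*-distribˡ-+ (suc k) (binom k (suc j)) (binom k j)) ⟩
  suc k * (binom k (suc j) + binom k j)
    ≡⟨ cong (suc k *_) (+-comm (binom k (suc j)) (binom k j)) ⟩
  suc k * binom (suc k) (suc j) ∎
  where open ≡-Reasoning

private
  odd-multiple : ∀ j c → suc j * c + j * c ≡ suc (2 * j) * c
  odd-multiple = solve-∀

binom-increasing : ∀ k j → suc (2 * j) ≤ k → binom k j ≤ binom k (suc j)
binom-increasing k j 2j+1≤k = *-cancelˡ-≤ (suc j) (+-cancelʳ-≤ (j * binom k j) _ _ (begin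
  suc j * binom k j + j * binom k j        ≡⟨ odd-multiple j (binom k j) ⟩
  suc (2 * j) * binom k j                  ≤⟨ *-monoˡ-≤ (binom k j) 2j+1≤k ⟩
  k * binom k j                            ≡⟨ binom-ratio k j ⟨
  suc j * binom k (suc j) + j * binom k j  ∎))
  where open ≤-Reasoning

binom-decreasing : ∀ k j → k ≤ suc (2 * j) → binom k (suc j) ≤ binom k j
binom-decreasing k j k≤2j+1 = *-cancelˡ-≤ (suc j) (+-cancelʳ-≤ (j * binom k j) _ _ (begin
  suc j * binom k (suc j) + j * binom k j  ≡⟨ binom-ratio k j ⟩
  k * binom k j                            ≤⟨ *-monoˡ-≤ (binom k j) k≤2j+1 ⟩
  suc (2 * j) * binom k j                  ≡⟨ odd-multiple j (binom k j) ⟨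
  suc j * binom k j + j * binom k j        ∎))
  where open ≤-Reasoning

k≤2⌈k/2⌉ : ∀ k → k ≤ 2 * ⌈ k /2⌉
k≤2⌈k/2⌉ zero          = z≤n
k≤2⌈k/2⌉ (suc zero)    = s≤s z≤n
k≤2⌈k/2⌉ (suc (suc k)) = subst (suc (suc k) ≤_) (sym (*-suc 2 ⌈ k /2⌉)) (s≤s (s≤s (k≤2⌈k/2⌉ k)))

2⌈k/2⌉≤1+k : ∀ k → 2 * ⌈ k /2⌉ ≤ suc k
2⌈k/2⌉≤1+k zero          = z≤n
2⌈k/2⌉≤1+k (suc zero)    = ≤-refl
2⌈k/2⌉≤1+k (suc (suc k)) = subst (_≤ suc (suc (suc k))) (sym (*-suc 2 ⌈ k /2⌉)) (s≤s (s≤s (2⌈k/2⌉≤1+k k)))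

centralBinom : ℕ → ℕ
centralBinom k = binom k ⌈ k /2⌉

binom≤centralBinom : ∀ k j → binom k j ≤ centralBinom k
binom≤centralBinom k j with ≤-total j ⌈ k /2⌉
... | inj₁ j≤mid = let (d , j+d≡mid) = m≤n⇒∃[o]m+o≡n j≤mid in rising d j j+d≡mid
  where
  rising : ∀ d j → j + d ≡ ⌈ k /2⌉ → binom k j ≤ centralBinom k
  rising zero    j j≡mid rewrite +-identityʳ j | j≡mid = ≤-refl
  rising (suc d) j j+d+1≡mid = ≤-trans (binom-increasing k j (≤-pred (begin
      suc (suc (2 * j))          ≤⟨ s≤s (s≤s (*-monoʳ-≤ 2 (m≤m+n j d))) ⟩
      2 + 2 * (j + d)            ≡⟨ *-suc 2 (j + d) ⟨
      2 * suc (j + d)            ≡⟨ cong (2 *_) (trans (sym (+-suc j d)) j+d+1≡mid) ⟩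
      2 * ⌈ k /2⌉                ≤⟨ 2⌈k/2⌉≤1+k k ⟩
      suc k                      ∎)))
    (rising d (suc j) (trans (sym (+-suc j d)) j+d+1≡mid))
    where open ≤-Reasoning
... | inj₂ mid≤j = let (d , mid+d≡j) = m≤n⇒∃[o]m+o≡n mid≤j in
  subst (λ i → binom k i ≤ centralBinom k) mid+d≡j (falling d)
  where
  falling : ∀ d → binom k (⌈ k /2⌉ + d) ≤ centralBinom k
  falling zero    rewrite +-identityʳ ⌈ k /2⌉ = ≤-refl
  falling (suc d) = ≤-trans
    (subst (λ i → binom k i ≤ binom k (⌈ k /2⌉ + d)) (sym (+-suc ⌈ k /2⌉ d))
      (binom-decreasing k (⌈ k /2⌉ + d) (≤-trans (k≤2⌈k/2⌉ k)
        (≤-trans (*-monoʳ-≤ 2 (m≤m+n ⌈ k /2⌉ d)) (n≤1+n _)))))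
    (falling d)

evenCentral : ℕ → ℕ
evenCentral n = binom (n + n) n

oddCentral : ℕ → ℕ
oddCentral n = binom (suc (n + n)) (suc n)

oddCentral-absorb : ∀ n → suc n * oddCentral n ≡ suc (n + n) * evenCentral n
oddCentral-absorb n = binom-absorb (n + n) n

binom-middle-symmetric : ∀ n → binom (suc (n + n)) n ≡ oddCentral n
binom-middle-symmetric n =
  sym (*-cancelˡ-≡ _ _ (suc n) (+-cancelʳ-≡ _ _ _
    (trans (binom-ratio k n) (sym (odd-multiple′ n (binom k n))))))
  where
  k = suc (n + n)
  odd-multiple′ : ∀ n c → suc n * c + n * c ≡ suc (n + n) * c
  odd-multiple′ = solve-∀

evenCentral-suc : ∀ n → evenCentral (suc n) ≡ 2 * oddCentral n
evenCentral-suc n = begin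
  binom (suc n + suc n) (suc n)                  ≡⟨ cong (λ m → binom (suc m) (suc n)) (+-suc n n) ⟩
  binom (suc (n + n)) n + oddCentral n           ≡⟨ cong (_+ oddCentral n) (binom-middle-symmetric n) ⟩
  oddCentral n + oddCentral n                    ≡⟨ cong (_+_ (oddCentral n)) (+-identityʳ (oddCentral n)) ⟨
  2 * oddCentral n                               ∎
  where open ≡-Reasoning

-- C(2n, n)² (2n+1) ≤ 16ⁿ, by induction using C(2n+2, n+1) (n+1) = 2 (2n+1) C(2n, n).
evenCentral-bound : ∀ n → evenCentral n * evenCentral n * suc (n + n) ≤ 16 ^ n
evenCentral-bound zero    = ≤-refl
evenCentral-bound (suc n) = *-cancelˡ-≤ (suc n * suc n) (begin
  suc n * suc n * (E′ * E′ * suc (suc n + suc n))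
    ≡⟨ cong (λ e → suc n * suc n * (e * e * suc (suc n + suc n))) (evenCentral-suc n) ⟩
  suc n * suc n * ((2 * O) * (2 * O) * suc (suc n + suc n))
    ≡⟨ regroup₁ n O ⟩
  4 * ((suc n * O) * (suc n * O)) * suc (suc n + suc n)
    ≡⟨ cong (λ o → 4 * (o * o) * suc (suc n + suc n)) (oddCentral-absorb n) ⟩
  4 * ((suc (n + n) * E) * (suc (n + n) * E)) * suc (suc n + suc n)
    ≡⟨ regroup₂ n E ⟩
  (4 * (suc (n + n) * suc (suc (suc (n + n))))) * (E * E * suc (n + n))
    ≤⟨ *-monoʳ-≤ (4 * (suc (n + n) * suc (suc (suc (n + n))))) (evenCentral-bound n) ⟩
  (4 * (suc (n + n) * suc (suc (suc (n + n))))) * 16 ^ n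
    ≤⟨ *-monoˡ-≤ (16 ^ n) (*-monoʳ-≤ 4 (subst (suc (n + n) * suc (suc (suc (n + n))) ≤_) (sym (square-gap n)) (m≤m+n _ 1))) ⟩
  (4 * (4 * (suc n * suc n))) * 16 ^ n
    ≡⟨ regroup₃ (suc n * suc n) (16 ^ n) ⟩
  suc n * suc n * (16 * 16 ^ n) ∎)
  where
  open ≤-Reasoning
  E  = evenCentral n
  E′ = evenCentral (suc n)
  O  = oddCentral n
  regroup₁ : ∀ n o → suc n * suc n * ((2 * o) * (2 * o) * suc (suc n + suc n))
                   ≡ 4 * ((suc n * o) * (suc n * o)) * suc (suc n + suc n)
  regroup₁ = solve-∀
  regroup₂ : ∀ n e → 4 * ((suc (n + n) * e) * (suc (n + n) * e)) * suc (suc n + suc n)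
                   ≡ (4 * (suc (n + n) * suc (suc (suc (n + n))))) * (e * e * suc (n + n))
  regroup₂ = solve-∀
  regroup₃ : ∀ a y → (4 * (4 * a)) * y ≡ a * (16 * y)
  regroup₃ = solve-∀
  square-gap : ∀ n → 4 * (suc n * suc n) ≡ suc (n + n) * suc (suc (suc (n + n))) + 1
  square-gap = solve-∀

-- C(2n+1, n+1)² (2n+2) ≤ 4·16ⁿ, from the even bound via (n+1) C(2n+1, n+1) = (2n+1) C(2n, n).
oddCentral-bound : ∀ n → oddCentral n * oddCentral n * suc (suc (n + n)) ≤ 4 * 16 ^ n
oddCentral-bound n = *-cancelˡ-≤ (suc n * suc n) (begin
  suc n * suc n * (O * O * suc (suc (n + n)))
    ≡⟨ regroup₁ n O ⟩
  (suc n * O) * (suc n * O) * suc (suc (n + n))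
    ≡⟨ cong (λ o → o * o * suc (suc (n + n))) (oddCentral-absorb n) ⟩
  (suc (n + n) * E) * (suc (n + n) * E) * suc (suc (n + n))
    ≡⟨ regroup₂ n E ⟩
  (suc (n + n) * suc (suc (n + n))) * (E * E * suc (n + n))
    ≤⟨ *-monoʳ-≤ (suc (n + n) * suc (suc (n + n))) (evenCentral-bound n) ⟩
  (suc (n + n) * suc (suc (n + n))) * 16 ^ n
    ≤⟨ *-monoˡ-≤ (16 ^ n) (subst (suc (n + n) * suc (suc (n + n)) ≤_) (sym (square-gap n)) (m≤m+n _ _)) ⟩
  (4 * (suc n * suc n)) * 16 ^ n
    ≡⟨ regroup₃ (suc n * suc n) (16 ^ n) ⟩
  suc n * suc n * (4 * 16 ^ n) ∎)
  where
  open ≤-Reasoning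
  E = evenCentral n
  O = oddCentral n
  regroup₁ : ∀ n o → suc n * suc n * (o * o * suc (suc (n + n))) ≡ (suc n * o) * (suc n * o) * suc (suc (n + n))
  regroup₁ = solve-∀
  regroup₂ : ∀ n e → (suc (n + n) * e) * (suc (n + n) * e) * suc (suc (n + n))
                   ≡ (suc (n + n) * suc (suc (n + n))) * (e * e * suc (n + n))
  regroup₂ = solve-∀
  regroup₃ : ∀ a y → (4 * a) * y ≡ a * (4 * y)
  regroup₃ = solve-∀
  square-gap : ∀ n → 4 * (suc n * suc n) ≡ suc (n + n) * suc (suc (n + n)) + (suc (suc n) + n)
  square-gap = solve-∀

4^[n+n]≡16^n : ∀ n → 4 ^ (n + n) ≡ 16 ^ n
4^[n+n]≡16^n n = trans (cong (λ e → 4 ^ (n + e)) (sym (+-identityʳ n))) (sym (^-*-assoc 4 2 n))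

even-or-odd : ∀ k → ∃ λ n → (k ≡ n + n) ⊎ (k ≡ suc (n + n))
even-or-odd zero    = 0 , inj₁ refl
even-or-odd (suc k) with even-or-odd k
... | n , inj₁ k≡2n   = n , inj₂ (cong suc k≡2n)
... | n , inj₂ k≡2n+1 = suc n , inj₁ (trans (cong suc k≡2n+1) (cong suc (sym (+-suc n n))))

centralBinom-bound : ∀ k → centralBinom k * centralBinom k * suc k ≤ 4 ^ k
centralBinom-bound k with even-or-odd k
... | n , inj₁ refl rewrite sym (n≡⌈n+n/2⌉ n) | 4^[n+n]≡16^n n = evenCentral-bound n
... | n , inj₂ refl rewrite sym (n≡⌊n+n/2⌋ n) =
  subst (oddCentral n * oddCentral n * suc (suc (n + n)) ≤_) (cong (4 *_) (sym (4^[n+n]≡16^n n))) (oddCentral-bound n)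

-- Sum over the endpoints (i, j), i + j = m, of monotone lattice paths of length m, each
-- endpoint counted with its number C(m, i) of paths: pathSum m g = Σ_{i+j=m} C(m,i) g(i,j).
pathSum : ℕ → (ℕ → ℕ → ℕ) → ℕ
pathSum zero    g = g 0 0
pathSum (suc m) g = pathSum m (λ i j → g (suc i) j) + pathSum m (λ i j → g i (suc j))

pathSum-cong : ∀ m {g h : ℕ → ℕ → ℕ} → (∀ i j → g i j ≡ h i j) → pathSum m g ≡ pathSum m h
pathSum-cong zero    g≡h = g≡h 0 0
pathSum-cong (suc m) g≡h =
  cong₂ _+_ (pathSum-cong m (λ i j → g≡h (suc i) j)) (pathSum-cong m (λ i j → g≡h i (suc j)))

pathSum-mono : ∀ m {g h : ℕ → ℕ → ℕ} → (∀ i j → g i j ≤ h i j) → pathSum m g ≤ pathSum m h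
pathSum-mono zero    g≤h = g≤h 0 0
pathSum-mono (suc m) g≤h =
  +-mono-≤ (pathSum-mono m (λ i j → g≤h (suc i) j)) (pathSum-mono m (λ i j → g≤h i (suc j)))

pathSum-+ : ∀ m (g h : ℕ → ℕ → ℕ) → pathSum m (λ i j → g i j + h i j) ≡ pathSum m g + pathSum m h
pathSum-+ zero    g h = refl
pathSum-+ (suc m) g h =
  trans (cong₂ _+_ (pathSum-+ m (λ i j → g (suc i) j) (λ i j → h (suc i) j))
                   (pathSum-+ m (λ i j → g i (suc j)) (λ i j → h i (suc j))))
        (+-interchange (pathSum m (λ i j → g (suc i) j)) (pathSum m (λ i j → h (suc i) j)) _ _)

pathSum-* : ∀ m c (g : ℕ → ℕ → ℕ) → pathSum m (λ i j → c * g i j) ≡ c * pathSum m g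
pathSum-* zero    c g = refl
pathSum-* (suc m) c g =
  trans (cong₂ _+_ (pathSum-* m c (λ i j → g (suc i) j)) (pathSum-* m c (λ i j → g i (suc j))))
        (sym (*-distribˡ-+ c _ _))

jWeighted : (ℕ → ℕ → ℕ) → ℕ → ℕ → ℕ
jWeighted h i zero    = 0
jWeighted h i (suc j) = suc j * h i j

-- Counting the extra j-step: Σ_{i+j=m+1} C(m+1,i) j h(i,j−1) = (m+1) Σ_{i+j=m} C(m,i) h(i,j).
pathSum-jWeighted : ∀ m (h : ℕ → ℕ → ℕ) → suc m * pathSum m h ≡ pathSum (suc m) (jWeighted h)
pathSum-jWeighted zero    h = trans (+-identityʳ (h 0 0)) (sym (+-identityʳ (h 0 0)))
pathSum-jWeighted (suc m) h = begin
  suc (suc m) * (A + B)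
    ≡⟨ spread (suc m) A B ⟩
  suc m * A + (pathSum (suc m) h + suc m * B)
    ≡⟨ cong₂ (λ u v → u + (pathSum (suc m) h + v)) (pathSum-jWeighted m hᵢ) (pathSum-jWeighted m hⱼ) ⟩
  pathSum (suc m) (jWeighted hᵢ) + (pathSum (suc m) h + pathSum (suc m) (jWeighted hⱼ))
    ≡⟨ cong₂ _+_ (pathSum-cong (suc m) stepᵢ)
                 (sym (trans (pathSum-cong (suc m) stepⱼ) (pathSum-+ (suc m) h (jWeighted hⱼ)))) ⟩
  pathSum (suc m) (λ i j → jWeighted h (suc i) j) + pathSum (suc m) (λ i j → jWeighted h i (suc j)) ∎
  where
  open ≡-Reasoning
  hᵢ = λ i j → h (suc i) j
  hⱼ = λ i j → h i (suc j)
  A = pathSum m hᵢ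
  B = pathSum m hⱼ
  spread : ∀ M a b → suc M * (a + b) ≡ M * a + ((a + b) + M * b)
  spread = solve-∀
  stepᵢ : ∀ i j → jWeighted hᵢ i j ≡ jWeighted h (suc i) j
  stepᵢ i zero    = refl
  stepᵢ i (suc j) = refl
  stepⱼ : ∀ i j → jWeighted h i (suc j) ≡ h i j + jWeighted hⱼ i j
  stepⱼ i zero    = refl
  stepⱼ i (suc j) = refl

pathSum-4^ : ∀ m → pathSum m (λ i j → 4 ^ (i + j)) ≡ 8 ^ m
pathSum-4^ zero    = refl
pathSum-4^ (suc m) = begin
  pathSum m (λ i j → 4 ^ (suc i + j)) + pathSum m (λ i j → 4 ^ (i + suc j))
    ≡⟨ cong (_+_ (pathSum m (λ i j → 4 ^ (suc i + j)))) (pathSum-cong m (λ i j → cong (4 ^_) (+-suc i j))) ⟩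
  pathSum m (λ i j → 4 * 4 ^ (i + j)) + pathSum m (λ i j → 4 * 4 ^ (i + j))
    ≡⟨ cong (λ s → s + s) (pathSum-* m 4 (λ i j → 4 ^ (i + j))) ⟩
  4 * pathSum m (λ i j → 4 ^ (i + j)) + 4 * pathSum m (λ i j → 4 ^ (i + j))
    ≡⟨ cong (λ s → 4 * s + 4 * s) (pathSum-4^ m) ⟩
  4 * 8 ^ m + 4 * 8 ^ m
    ≡⟨ double (8 ^ m) ⟩
  8 * 8 ^ m ∎
  where
  open ≡-Reasoning
  double : ∀ x → 4 * x + 4 * x ≡ 8 * x
  double = solve-∀

-- It bounds the smoothed digit counts after m
-- "mixed" digit pairs (see `digits-gain`).
potential : ℕ → ℕ → ℕ
potential zero    k = centralBinom k
potential (suc m) k = potential m (suc k) + 2 * potential m k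

quadraticPotential : ℕ → ℕ → ℕ
quadraticPotential m k = pathSum m (λ i j → 4 ^ i * (centralBinom (k + j) * centralBinom (k + j)))

quadraticPotential-suc : ∀ m k →
  quadraticPotential (suc m) k ≡ 4 * quadraticPotential m k + quadraticPotential m (suc k)
quadraticPotential-suc m k = cong₂ _+_
  (trans (pathSum-cong m (λ i j → *-assoc 4 (4 ^ i) _)) (pathSum-* m 4 _))
  (pathSum-cong m (λ i j → cong (λ n → 4 ^ i * (centralBinom n * centralBinom n)) (+-suc k j)))

2xy≤x²+y² : ∀ x y → 2 * x * y ≤ x * x + y * y
2xy≤x²+y² x y with ≤-total x y
... | inj₁ x≤y = let (d , x+d≡y) = m≤n⇒∃[o]m+o≡n x≤y in
  subst (λ y → 2 * x * y ≤ x * x + y * y) x+d≡y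
    (subst (2 * x * (x + d) ≤_) (sym (expand x d)) (m≤m+n _ _))
  where
  expand : ∀ x d → x * x + (x + d) * (x + d) ≡ 2 * x * (x + d) + d * d
  expand = solve-∀
... | inj₂ y≤x = let (d , y+d≡x) = m≤n⇒∃[o]m+o≡n y≤x in
  subst (λ x → 2 * x * y ≤ x * x + y * y) y+d≡x
    (subst (2 * (y + d) * y ≤_) (sym (expand y d)) (m≤m+n _ _))
  where
  expand : ∀ y d → (y + d) * (y + d) + y * y ≡ 2 * (y + d) * y + d * d
  expand = solve-∀

cauchy-schwarz₂ : ∀ a b → (a + 2 * b) * (a + 2 * b) ≤ 2 * (a * a + 4 * (b * b))
cauchy-schwarz₂ a b = begin
  (a + 2 * b) * (a + 2 * b)                           ≡⟨ expand a b ⟩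
  a * a + 4 * (b * b) + 2 * a * (2 * b)               ≤⟨ +-monoʳ-≤ (a * a + 4 * (b * b)) (2xy≤x²+y² a (2 * b)) ⟩
  a * a + 4 * (b * b) + (a * a + (2 * b) * (2 * b))   ≡⟨ collect a b ⟩
  2 * (a * a + 4 * (b * b))                           ∎
  where
  open ≤-Reasoning
  expand : ∀ a b → (a + 2 * b) * (a + 2 * b) ≡ a * a + 4 * (b * b) + 2 * a * (2 * b)
  expand = solve-∀
  collect : ∀ a b → a * a + 4 * (b * b) + (a * a + (2 * b) * (2 * b)) ≡ 2 * (a * a + 4 * (b * b))
  collect = solve-∀

-- H(m, k)² ≤ 2^m Q(m, k), by Cauchy–Schwarz at each step of the recursion.
potential²≤quadraticPotential : ∀ m k → potential m k * potential m k ≤ 2 ^ m * quadraticPotential m k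
potential²≤quadraticPotential zero    k rewrite +-identityʳ k = ≤-trans (m≤m+n _ 0) (m≤m+n _ 0)
potential²≤quadraticPotential (suc m) k = begin
  (a + 2 * b) * (a + 2 * b)
    ≤⟨ cauchy-schwarz₂ a b ⟩
  2 * (a * a + 4 * (b * b))
    ≤⟨ *-monoʳ-≤ 2 (+-mono-≤ (potential²≤quadraticPotential m (suc k))
                             (*-monoʳ-≤ 4 (potential²≤quadraticPotential m k))) ⟩
  2 * (2 ^ m * quadraticPotential m (suc k) + 4 * (2 ^ m * quadraticPotential m k))
    ≡⟨ regroup (2 ^ m) (quadraticPotential m (suc k)) (quadraticPotential m k) ⟩
  2 * 2 ^ m * (4 * quadraticPotential m k + quadraticPotential m (suc k))
    ≡⟨ cong (2 * 2 ^ m *_) (quadraticPotential-suc m k) ⟨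
  2 ^ suc m * quadraticPotential (suc m) k ∎
  where
  open ≤-Reasoning
  a = potential m (suc k)
  b = potential m k
  regroup : ∀ p x y → 2 * (p * x + 4 * (p * y)) ≡ 2 * p * (4 * y + x)
  regroup = solve-∀

-- (m+1) Q(m, 0) ≤ 8^{m+1}: weighting by j turns C_j² into C_j² (j+1) ≤ 4^j.
quadraticPotential-bound : ∀ m → suc m * quadraticPotential m 0 ≤ 8 ^ suc m
quadraticPotential-bound m = begin
  suc m * quadraticPotential m 0             ≡⟨ pathSum-jWeighted m h ⟩
  pathSum (suc m) (jWeighted h)              ≤⟨ pathSum-mono (suc m) weighted≤4^ ⟩
  pathSum (suc m) (λ i j → 4 ^ (i + j))      ≡⟨ pathSum-4^ (suc m) ⟩
  8 ^ suc m                                  ∎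
  where
  open ≤-Reasoning
  h : ℕ → ℕ → ℕ
  h i j = 4 ^ i * (centralBinom j * centralBinom j)
  weighted≤4^ : ∀ i j → jWeighted h i j ≤ 4 ^ (i + j)
  weighted≤4^ i zero    = z≤n
  weighted≤4^ i (suc j) = begin
    suc j * (4 ^ i * (centralBinom j * centralBinom j))  ≡⟨ regroup (suc j) (4 ^ i) _ ⟩
    4 ^ i * (centralBinom j * centralBinom j * suc j)    ≤⟨ *-monoʳ-≤ (4 ^ i) (centralBinom-bound j) ⟩
    4 ^ i * 4 ^ j                                        ≤⟨ *-monoʳ-≤ (4 ^ i) (m≤m+n (4 ^ j) _) ⟩
    4 ^ i * 4 ^ suc j                                    ≡⟨ ^-distribˡ-+-* 4 i (suc j) ⟨
    4 ^ (i + suc j)                                      ∎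
    where
    regroup : ∀ a b c → a * (b * c) ≡ b * (c * a)
    regroup = solve-∀

potential-bound : ∀ m → potential m 0 * potential m 0 * suc m ≤ 8 * 16 ^ m
potential-bound m = begin
  potential m 0 * potential m 0 * suc m        ≤⟨ *-monoˡ-≤ (suc m) (potential²≤quadraticPotential m 0) ⟩
  2 ^ m * quadraticPotential m 0 * suc m       ≡⟨ regroup₁ (2 ^ m) (quadraticPotential m 0) (suc m) ⟩
  2 ^ m * (suc m * quadraticPotential m 0)     ≤⟨ *-monoʳ-≤ (2 ^ m) (quadraticPotential-bound m) ⟩
  2 ^ m * (8 * 8 ^ m)                          ≡⟨ regroup₂ (2 ^ m) (8 ^ m) ⟩
  8 * (2 ^ m * 8 ^ m)                          ≡⟨ cong (8 *_) (2^m*8^m≡16^m m) ⟩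
  8 * 16 ^ m                                   ∎
  where
  open ≤-Reasoning
  regroup₁ : ∀ a b c → a * b * c ≡ a * (c * b)
  regroup₁ = solve-∀
  regroup₂ : ∀ a b → a * (8 * b) ≡ 8 * (a * b)
  regroup₂ = solve-∀
  2^m*8^m≡16^m : ∀ m → 2 ^ m * 8 ^ m ≡ 16 ^ m
  2^m*8^m≡16^m zero    = refl
  2^m*8^m≡16^m (suc m) = trans (regroup₃ (2 ^ m) (8 ^ m)) (cong (16 *_) (2^m*8^m≡16^m m))
    where
    regroup₃ : ∀ a b → 2 * a * (8 * b) ≡ 16 * (a * b)
    regroup₃ = solve-∀

[2y]%2≡0 : ∀ y → (y * 2) % 2 ≡ 0
[2y]%2≡0 y = m*n%n≡0 y 2

[2y+1]%2≡1 : ∀ y → suc (y * 2) % 2 ≡ 1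
[2y+1]%2≡1 y = [m+kn]%n≡m%n 1 y 2

[2y+1]/2≡y : ∀ y → suc (y * 2) / 2 ≡ y
[2y+1]/2≡y y = trans (+-distrib-/-∣ʳ 1 {d = 2} (divides y refl)) (m*n/n≡m y 2)

n≤1+f⇒n/2≤f : ∀ n f → n ≤ suc f → n / 2 ≤ f
n≤1+f⇒n/2≤f zero    f _     = z≤n
n≤1+f⇒n/2≤f (suc n) f n≤1+f = ≤-pred (≤-trans (m/n<m (suc n) 2 (s≤s (s≤s z≤n))) n≤1+f)

s₂-fuel-stable : ∀ f g n → n ≤ f → n ≤ g → s₂-fuel f n ≡ s₂-fuel g n
s₂-fuel-stable zero    zero    n       _   _   = refl
s₂-fuel-stable zero    (suc g) zero    _   _   = s₂-fuel-stable zero g 0 z≤n z≤n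
s₂-fuel-stable (suc f) zero    zero    _   _   = s₂-fuel-stable f zero 0 z≤n z≤n
s₂-fuel-stable (suc f) (suc g) n       n≤f n≤g =
  cong (λ s → n % 2 + s) (s₂-fuel-stable f g (n / 2) (n≤1+f⇒n/2≤f n f n≤f) (n≤1+f⇒n/2≤f n g n≤g))

s₂-fuel≡s₂ : ∀ f n → n ≤ f → s₂-fuel f n ≡ s₂ n
s₂-fuel≡s₂ f n n≤f = s₂-fuel-stable f n n n≤f ≤-refl

s₂-even : ∀ y → s₂ (y * 2) ≡ s₂ y
s₂-even y = begin
  s₂ (y * 2)                                    ≡⟨ s₂-fuel≡s₂ (suc (y * 2)) (y * 2) (n≤1+n _) ⟨
  (y * 2) % 2 + s₂-fuel (y * 2) ((y * 2) / 2)   ≡⟨ cong₂ (λ r q → r + s₂-fuel (y * 2) q) ([2y]%2≡0 y) (m*n/n≡m y 2) ⟩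
  s₂-fuel (y * 2) y                             ≡⟨ s₂-fuel≡s₂ (y * 2) y (m≤m*n y 2) ⟩
  s₂ y                                          ∎
  where open ≡-Reasoning

s₂-odd : ∀ y → s₂ (suc (y * 2)) ≡ suc (s₂ y)
s₂-odd y = begin
  s₂ (suc (y * 2))
    ≡⟨ s₂-fuel≡s₂ (suc (suc (y * 2))) (suc (y * 2)) (n≤1+n _) ⟨
  suc (y * 2) % 2 + s₂-fuel (suc (y * 2)) (suc (y * 2) / 2)
    ≡⟨ cong₂ (λ r q → r + s₂-fuel (suc (y * 2)) q) ([2y+1]%2≡1 y) ([2y+1]/2≡y y) ⟩
  suc (s₂-fuel (suc (y * 2)) y)
    ≡⟨ cong suc (s₂-fuel≡s₂ (suc (y * 2)) y (≤-trans (m≤m*n y 2) (n≤1+n _))) ⟩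
  suc (s₂ y) ∎
  where open ≡-Reasoning

digitDiff : ℕ → ℕ → ℤ
digitDiff w x = (+ s₂ (x + w)) ℤ.- (+ s₂ x)

-- How D_w(x) depends on the last binary digits of w and x (a carry appears only for 1 + 1).
digitDiff-even-even : ∀ v y → digitDiff (v * 2) (y * 2) ≡ digitDiff v y
digitDiff-even-even v y = cong₂ (λ p q → (+ p) ℤ.- (+ q))
  (trans (cong s₂ (sum-parity y v)) (s₂-even (y + v))) (s₂-even y)
  where
  sum-parity : ∀ y v → y * 2 + v * 2 ≡ (y + v) * 2
  sum-parity = solve-∀

digitDiff-even-odd : ∀ v y → digitDiff (v * 2) (suc (y * 2)) ≡ digitDiff v y
digitDiff-even-odd v y = trans
  (cong₂ (λ p q → (+ p) ℤ.- (+ q)) (trans (cong s₂ (sum-parity y v)) (s₂-odd (y + v))) (s₂-odd y))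
  (cancel (+ s₂ (y + v)) (+ s₂ y))
  where
  sum-parity : ∀ y v → suc (y * 2) + v * 2 ≡ suc ((y + v) * 2)
  sum-parity = solve-∀
  cancel : ∀ (p q : ℤ) → (ℤ.+ 1 ℤ.+ p) ℤ.- (ℤ.+ 1 ℤ.+ q) ≡ p ℤ.- q
  cancel = ℤ-Solver.solve-∀

digitDiff-odd-even : ∀ v y → digitDiff (suc (v * 2)) (y * 2) ≡ ℤ.+ 1 ℤ.+ digitDiff v y
digitDiff-odd-even v y = trans
  (cong₂ (λ p q → (+ p) ℤ.- (+ q)) (trans (cong s₂ (sum-parity y v)) (s₂-odd (y + v))) (s₂-even y))
  (regroup (+ s₂ (y + v)) (+ s₂ y))
  where
  sum-parity : ∀ y v → y * 2 + suc (v * 2) ≡ suc ((y + v) * 2)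
  sum-parity = solve-∀
  regroup : ∀ (p q : ℤ) → (ℤ.+ 1 ℤ.+ p) ℤ.- q ≡ ℤ.+ 1 ℤ.+ (p ℤ.- q)
  regroup = ℤ-Solver.solve-∀

digitDiff-odd-odd : ∀ v y → digitDiff (suc (v * 2)) (suc (y * 2)) ≡ digitDiff (suc v) y ℤ.- ℤ.+ 1
digitDiff-odd-odd v y = trans
  (cong₂ (λ p q → (+ p) ℤ.- (+ q)) (trans (cong s₂ (sum-parity y v)) (s₂-even (y + suc v))) (s₂-odd y))
  (regroup (+ s₂ (y + suc v)) (+ s₂ y))
  where
  sum-parity : ∀ y v → suc (y * 2) + suc (v * 2) ≡ (y + suc v) * 2
  sum-parity = solve-∀
  regroup : ∀ (p q : ℤ) → p ℤ.- (ℤ.+ 1 ℤ.+ q) ≡ (p ℤ.- q) ℤ.- ℤ.+ 1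
  regroup = ℤ-Solver.solve-∀

binomℤ : ℕ → ℤ → ℕ
binomℤ k (+ j)    = binom k j
binomℤ k -[1+ j ] = 0

binomℤ-pascal : ∀ k z → binomℤ (suc k) z ≡ binomℤ k z + binomℤ k (z ℤ.- + 1)
binomℤ-pascal k (+ zero)  = trans (sym (binom-zero k)) (sym (+-identityʳ _))
binomℤ-pascal k (+ suc j) = +-comm (binom k j) (binom k (suc j))
binomℤ-pascal k -[1+ j ]  = refl

binomℤ-0-off-centre : ∀ z → z ≢ + 0 → binomℤ 0 z ≡ 0
binomℤ-0-off-centre (+ zero)  z≢0 = contradiction refl z≢0
binomℤ-0-off-centre (+ suc j) _   = refl
binomℤ-0-off-centre -[1+ j ]  _   = refl

binomℤ≤centralBinom : ∀ k z → binomℤ k z ≤ centralBinom k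
binomℤ≤centralBinom k (+ j)    = binom≤centralBinom k j
binomℤ≤centralBinom k -[1+ j ] = z≤n

-- The smoothed count Σ_{x<M} C(k, e − D_w(x)).  For k = 0 it is the number of x < M with
-- D_w(x) = e; raising k convolves the distribution of D_w with k fair coin flips.
smoothedCount : ℕ → ℕ → ℕ → ℤ → ℕ
smoothedCount k w M e = sumBelow (λ x → binomℤ k (e ℤ.- digitDiff w x)) M

smoothedCount-pascal : ∀ k w M e →
  smoothedCount (suc k) w M e ≡ smoothedCount k w M e + smoothedCount k w M (e ℤ.- + 1)
smoothedCount-pascal k w M e =
  trans (sumBelow-cong M (λ x → trans (binomℤ-pascal k (e ℤ.- digitDiff w x))
                                      (cong (λ z → binomℤ k (e ℤ.- digitDiff w x) + binomℤ k z)
                                            (shift e (digitDiff w x)))))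
        (sumBelow-+ _ _ M)
  where
  shift : ∀ (e d : ℤ) → (e ℤ.- d) ℤ.- + 1 ≡ (e ℤ.- + 1) ℤ.- d
  shift = ℤ-Solver.solve-∀

smoothedCount≤ : ∀ k w M e → smoothedCount k w M e ≤ M * centralBinom k
smoothedCount≤ k w M e = sumBelow-≤-const _ (centralBinom k) M (λ x → binomℤ≤centralBinom k (e ℤ.- digitDiff w x))

smoothedCount-even : ∀ k v M e → smoothedCount k (v * 2) (M * 2) e ≡ smoothedCount k v M e + smoothedCount k v M e
smoothedCount-even k v M e = begin
  smoothedCount k (v * 2) (M * 2) e
    ≡⟨ sumBelow-pairs (λ x → binomℤ k (e ℤ.- digitDiff (v * 2) x)) M ⟩
  sumBelow (λ y → binomℤ k (e ℤ.- digitDiff (v * 2) (y * 2)) + binomℤ k (e ℤ.- digitDiff (v * 2) (suc (y * 2)))) M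
    ≡⟨ sumBelow-cong M (λ y → cong₂ (λ p q → binomℤ k (e ℤ.- p) + binomℤ k (e ℤ.- q))
                                     (digitDiff-even-even v y) (digitDiff-even-odd v y)) ⟩
  sumBelow (λ y → binomℤ k (e ℤ.- digitDiff v y) + binomℤ k (e ℤ.- digitDiff v y)) M
    ≡⟨ sumBelow-+ _ _ M ⟩
  smoothedCount k v M e + smoothedCount k v M e ∎
  where open ≡-Reasoning

smoothedCount-odd : ∀ k v M e → smoothedCount k (suc (v * 2)) (M * 2) e
                              ≡ smoothedCount k v M (e ℤ.- + 1) + smoothedCount k (suc v) M (e ℤ.+ + 1)
smoothedCount-odd k v M e = begin
  smoothedCount k (suc (v * 2)) (M * 2) e
    ≡⟨ sumBelow-pairs (λ x → binomℤ k (e ℤ.- digitDiff (suc (v * 2)) x)) M ⟩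
  sumBelow (λ y → binomℤ k (e ℤ.- digitDiff (suc (v * 2)) (y * 2))
                + binomℤ k (e ℤ.- digitDiff (suc (v * 2)) (suc (y * 2)))) M
    ≡⟨ sumBelow-cong M (λ y → cong₂ (λ p q → binomℤ k p + binomℤ k q)
         (trans (cong (λ d → e ℤ.- d) (digitDiff-odd-even v y)) (carry-in e (digitDiff v y)))
         (trans (cong (λ d → e ℤ.- d) (digitDiff-odd-odd v y)) (carry-out e (digitDiff (suc v) y)))) ⟩
  sumBelow (λ y → binomℤ k ((e ℤ.- + 1) ℤ.- digitDiff v y) + binomℤ k ((e ℤ.+ + 1) ℤ.- digitDiff (suc v) y)) M
    ≡⟨ sumBelow-+ _ _ M ⟩
  smoothedCount k v M (e ℤ.- + 1) + smoothedCount k (suc v) M (e ℤ.+ + 1) ∎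
  where
  open ≡-Reasoning
  carry-in : ∀ (e d : ℤ) → e ℤ.- (+ 1 ℤ.+ d) ≡ (e ℤ.- + 1) ℤ.- d
  carry-in = ℤ-Solver.solve-∀
  carry-out : ∀ (e d : ℤ) → e ℤ.- (d ℤ.- + 1) ≡ (e ℤ.+ + 1) ℤ.- d
  carry-out = ℤ-Solver.solve-∀

-- Two digits of w processed at once, when the lower digit is 1 and absorbs no carry:
-- the three resulting counts recombine, by Pascal's rule, into one with k + 1 coins.
smoothedCount-mixed₀ : ∀ k v M e →
  smoothedCount k (suc (v * 2 * 2)) (M * 2 * 2) e
    ≡ smoothedCount (suc k) v M e + smoothedCount k v M (e ℤ.- + 1) + smoothedCount k (suc v) M (e ℤ.+ + 2)
smoothedCount-mixed₀ k v M e = begin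
  T k (suc (v * 2 * 2)) (M * 2 * 2) e
    ≡⟨ smoothedCount-odd k (v * 2) (M * 2) e ⟩
  T k (v * 2) (M * 2) (e ℤ.- + 1) + T k (suc (v * 2)) (M * 2) (e ℤ.+ + 1)
    ≡⟨ cong₂ _+_ (smoothedCount-even k v M (e ℤ.- + 1)) (smoothedCount-odd k v M (e ℤ.+ + 1)) ⟩
  (T k v M (e ℤ.- + 1) + T k v M (e ℤ.- + 1)) + (T k v M ((e ℤ.+ + 1) ℤ.- + 1) + T k (suc v) M ((e ℤ.+ + 1) ℤ.+ + 1))
    ≡⟨ cong₂ (λ p q → (T k v M (e ℤ.- + 1) + T k v M (e ℤ.- + 1)) + (T k v M p + T k (suc v) M q))
             (up-down e) (up-up e) ⟩
  (T k v M (e ℤ.- + 1) + T k v M (e ℤ.- + 1)) + (T k v M e + T k (suc v) M (e ℤ.+ + 2))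
    ≡⟨ regroup (T k v M (e ℤ.- + 1)) (T k v M e) (T k (suc v) M (e ℤ.+ + 2)) ⟩
  (T k v M e + T k v M (e ℤ.- + 1)) + T k v M (e ℤ.- + 1) + T k (suc v) M (e ℤ.+ + 2)
    ≡⟨ cong (λ s → s + T k v M (e ℤ.- + 1) + T k (suc v) M (e ℤ.+ + 2)) (smoothedCount-pascal k v M e) ⟨
  T (suc k) v M e + T k v M (e ℤ.- + 1) + T k (suc v) M (e ℤ.+ + 2) ∎
  where
  open ≡-Reasoning
  T = smoothedCount
  up-down : ∀ e → (e ℤ.+ + 1) ℤ.- + 1 ≡ e
  up-down = ℤ-Solver.solve-∀
  up-up : ∀ e → (e ℤ.+ + 1) ℤ.+ + 1 ≡ e ℤ.+ + 2
  up-up = ℤ-Solver.solve-∀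
  regroup : ∀ a b c → (a + a) + (b + c) ≡ (b + a) + a + c
  regroup = solve-∀

-- The same when the lower digit is 0 and absorbs an incoming carry.
smoothedCount-mixed₁ : ∀ k v M e →
  smoothedCount k (suc (suc (v * 2) * 2)) (M * 2 * 2) e
    ≡ smoothedCount (suc k) (suc v) M (e ℤ.+ + 1) + smoothedCount k v M (e ℤ.- + 2) + smoothedCount k (suc v) M (e ℤ.+ + 1)
smoothedCount-mixed₁ k v M e = begin
  T k (suc (suc (v * 2) * 2)) (M * 2 * 2) e
    ≡⟨ smoothedCount-odd k (suc (v * 2)) (M * 2) e ⟩
  T k (suc (v * 2)) (M * 2) (e ℤ.- + 1) + T k (suc v * 2) (M * 2) (e ℤ.+ + 1)
    ≡⟨ cong₂ _+_ (smoothedCount-odd k v M (e ℤ.- + 1)) (smoothedCount-even k (suc v) M (e ℤ.+ + 1)) ⟩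
  (T k v M ((e ℤ.- + 1) ℤ.- + 1) + T k (suc v) M ((e ℤ.- + 1) ℤ.+ + 1)) + (T k (suc v) M (e ℤ.+ + 1) + T k (suc v) M (e ℤ.+ + 1))
    ≡⟨ cong₂ (λ p q → (T k v M p + T k (suc v) M q) + (T k (suc v) M (e ℤ.+ + 1) + T k (suc v) M (e ℤ.+ + 1)))
             (down-down e) (down-up e) ⟩
  (T k v M (e ℤ.- + 2) + T k (suc v) M e) + (T k (suc v) M (e ℤ.+ + 1) + T k (suc v) M (e ℤ.+ + 1))
    ≡⟨ regroup (T k v M (e ℤ.- + 2)) (T k (suc v) M e) (T k (suc v) M (e ℤ.+ + 1)) ⟩
  (T k (suc v) M (e ℤ.+ + 1) + T k (suc v) M e) + T k v M (e ℤ.- + 2) + T k (suc v) M (e ℤ.+ + 1)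
    ≡⟨ cong (λ s → s + T k v M (e ℤ.- + 2) + T k (suc v) M (e ℤ.+ + 1))
            (trans (smoothedCount-pascal k (suc v) M (e ℤ.+ + 1))
                   (cong (λ p → T k (suc v) M (e ℤ.+ + 1) + T k (suc v) M p) (up-down e))) ⟨
  T (suc k) (suc v) M (e ℤ.+ + 1) + T k v M (e ℤ.- + 2) + T k (suc v) M (e ℤ.+ + 1) ∎
  where
  open ≡-Reasoning
  T = smoothedCount
  down-down : ∀ e → (e ℤ.- + 1) ℤ.- + 1 ≡ e ℤ.- + 2
  down-down = ℤ-Solver.solve-∀
  down-up : ∀ e → (e ℤ.- + 1) ℤ.+ + 1 ≡ e
  down-up = ℤ-Solver.solve-∀
  up-down : ∀ e → (e ℤ.+ + 1) ℤ.- + 1 ≡ e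
  up-down = ℤ-Solver.solve-∀
  regroup : ∀ a b c → (a + b) + (c + c) ≡ (c + b) + a + c
  regroup = solve-∀

-- w has gain m at scale P: over every multiple P·N of the scale, the smoothed counts of w are
-- at most 4^{-m} P · H(m, k) N, i.e. a factor 4^{-m} H(m, k) below the trivial bound.
record HasGain (m w P : ℕ) : Set where
  constructor gained
  field
    gain-bound : ∀ k N e → 4 ^ m * smoothedCount k w (P * N) e ≤ P * (potential m k * N)
open HasGain public

-- Every shift has gain 0: the trivial bound C(k, j) ≤ C(k, ⌈k/2⌉).
gain-zero : ∀ w P → HasGain 0 w P
gain-zero w P = gained λ k N e → begin
  1 * smoothedCount k w (P * N) e   ≡⟨ *-identityˡ _ ⟩
  smoothedCount k w (P * N) e       ≤⟨ smoothedCount≤ k w (P * N) e ⟩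
  P * N * centralBinom k            ≡⟨ regroup P N (centralBinom k) ⟩
  P * (centralBinom k * N)          ∎
  where
  open ≤-Reasoning
  regroup : ∀ a b c → a * b * c ≡ a * (c * b)
  regroup = solve-∀

gain-double : ∀ {m w P} → HasGain m w P → HasGain m (w * 2) (2 * P)
gain-double {m} {w} {P} (gained gain) = gained λ k N e → let T = smoothedCount k w (P * N) e in begin
  4 ^ m * smoothedCount k (w * 2) (2 * P * N) e     ≡⟨ cong (λ M → 4 ^ m * smoothedCount k (w * 2) M e) (regroup₁ P N) ⟩
  4 ^ m * smoothedCount k (w * 2) (P * N * 2) e     ≡⟨ cong (4 ^ m *_) (smoothedCount-even k w (P * N) e) ⟩
  4 ^ m * (T + T)                                   ≡⟨ *-distribˡ-+ (4 ^ m) T T ⟩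
  4 ^ m * T + 4 ^ m * T                             ≤⟨ +-mono-≤ (gain k N e) (gain k N e) ⟩
  P * (potential m k * N) + P * (potential m k * N) ≡⟨ regroup₂ P (potential m k * N) ⟩
  2 * P * (potential m k * N)                       ∎
  where
  open ≤-Reasoning
  regroup₁ : ∀ p n → 2 * p * n ≡ p * n * 2
  regroup₁ = solve-∀
  regroup₂ : ∀ a b → a * b + a * b ≡ 2 * a * b
  regroup₂ = solve-∀

-- Three counts with gain m and potentials H(m, k+1), H(m, k), H(m, k) combine to gain m + 1
-- at four times the scale, since H(m+1, k) = H(m, k+1) + 2 H(m, k).
gain-combine : ∀ q P N h₁ h₀ x y z → q * x ≤ P * (h₁ * N) → q * y ≤ P * (h₀ * N) → q * z ≤ P * (h₀ * N) →
               4 * q * (x + y + z) ≤ 2 * (2 * P) * ((h₁ + 2 * h₀) * N)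
gain-combine q P N h₁ h₀ x y z x≤ y≤ z≤ = begin
  4 * q * (x + y + z)                                    ≡⟨ spread q x y z ⟩
  4 * (q * x + q * y + q * z)                            ≤⟨ *-monoʳ-≤ 4 (+-mono-≤ (+-mono-≤ x≤ y≤) z≤) ⟩
  4 * (P * (h₁ * N) + P * (h₀ * N) + P * (h₀ * N))       ≡⟨ collect P N h₁ h₀ ⟩
  2 * (2 * P) * ((h₁ + 2 * h₀) * N)                      ∎
  where
  open ≤-Reasoning
  spread : ∀ q x y z → 4 * q * (x + y + z) ≡ 4 * (q * x + q * y + q * z)
  spread = solve-∀
  collect : ∀ P N h₁ h₀ → 4 * (P * (h₁ * N) + P * (h₀ * N) + P * (h₀ * N)) ≡ 2 * (2 * P) * ((h₁ + 2 * h₀) * N)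
  collect = solve-∀

private
  4PN≡PN*2*2 : ∀ P N → 2 * (2 * P) * N ≡ P * N * 2 * 2
  4PN≡PN*2*2 = solve-∀

gain-mixed₀ : ∀ {m v P} → HasGain m v P → HasGain m (suc v) P → HasGain (suc m) (suc (v * 2 * 2)) (2 * (2 * P))
gain-mixed₀ {m} {v} {P} (gained gainᵥ) (gained gainᵥ₊₁) = gained λ k N e →
  subst (λ T → 4 * 4 ^ m * T ≤ 2 * (2 * P) * (potential (suc m) k * N))
        (sym (trans (cong (λ M → smoothedCount k (suc (v * 2 * 2)) M e) (4PN≡PN*2*2 P N))
                    (smoothedCount-mixed₀ k v (P * N) e)))
        (gain-combine (4 ^ m) P N (potential m (suc k)) (potential m k) _ _ _
          (gainᵥ (suc k) N e) (gainᵥ k N (e ℤ.- + 1)) (gainᵥ₊₁ k N (e ℤ.+ + 2)))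

gain-mixed₁ : ∀ {m v P} → HasGain m v P → HasGain m (suc v) P → HasGain (suc m) (suc (suc (v * 2) * 2)) (2 * (2 * P))
gain-mixed₁ {m} {v} {P} (gained gainᵥ) (gained gainᵥ₊₁) = gained λ k N e →
  subst (λ T → 4 * 4 ^ m * T ≤ 2 * (2 * P) * (potential (suc m) k * N))
        (sym (trans (cong (λ M → smoothedCount k (suc (suc (v * 2) * 2)) M e) (4PN≡PN*2*2 P N))
                    (smoothedCount-mixed₁ k v (P * N) e)))
        (gain-combine (4 ^ m) P N (potential m (suc k)) (potential m k) _ _ _
          (gainᵥ₊₁ (suc k) N (e ℤ.+ + 1)) (gainᵥ k N (e ℤ.- + 2)) (gainᵥ₊₁ k N (e ℤ.+ + 1)))

bit : Bool → ℕ
bit false = 0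
bit true  = 1

-- The number with binary digit word as (least significant digit first).
value : List Bool → ℕ
value []      = 0
value (b ∷ r) = bit b + value r * 2

-- The greedy number of mixed digit pairs met while adding the word as with incoming carry c:
-- a digit equal to the carry just passes the carry on (w is even), a digit different from the
-- carry (w is odd) is paired with the next digit, after which either carry may come in.
mixedPairs : List Bool → Bool → ℕ
mixedPairs []              c     = 0
mixedPairs (false ∷ r)     false = mixedPairs r false
mixedPairs (true ∷ r)      true  = mixedPairs r true
mixedPairs (false ∷ [])    true  = 0
mixedPairs (true ∷ [])     false = 0
mixedPairs (false ∷ b ∷ r) true  = suc (mixedPairs r false ⊓ mixedPairs r true)
mixedPairs (true ∷ b ∷ r)  false = suc (mixedPairs r false ⊓ mixedPairs r true)

gain-mixed : ∀ b {m v P} → HasGain m v P → HasGain m (suc v) P → HasGain (suc m) (suc ((bit b + v * 2) * 2)) (2 * (2 * P))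
gain-mixed false = gain-mixed₀
gain-mixed true  = gain-mixed₁

carried : ∀ b r → value (b ∷ r) + bit b ≡ (value r + bit b) * 2
carried false r = trans (+-identityʳ _) (cong (_* 2) (sym (+-identityʳ (value r))))
carried true  r = double-plus-two (value r)
  where
  double-plus-two : ∀ v → suc (v * 2) + 1 ≡ (v + 1) * 2
  double-plus-two = solve-∀

gain-after-pair : ∀ b r {m} → (∀ c → m ≤ mixedPairs r c → HasGain m (value r + bit c) (2 ^ length r)) →
                  m ≤ mixedPairs r false ⊓ mixedPairs r true →
                  HasGain (suc m) (suc (value (b ∷ r) * 2)) (2 ^ length (false ∷ b ∷ r))
gain-after-pair b r {m} gain-r m≤pairs = gain-mixed b
  (subst (λ w → HasGain m w (2 ^ length r)) (+-identityʳ (value r)) (gain-r false (m≤n⊓o⇒m≤n _ _ m≤pairs)))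
  (subst (λ w → HasGain m w (2 ^ length r)) (+-comm (value r) 1) (gain-r true (m≤n⊓o⇒m≤o _ _ m≤pairs)))

digits-gain : ∀ as c m → m ≤ mixedPairs as c → HasGain m (value as + bit c) (2 ^ length as)
digits-gain as              c     zero    _        = gain-zero (value as + bit c) (2 ^ length as)
digits-gain (false ∷ r)     false m       m≤pairs  =
  subst (λ w → HasGain m w (2 ^ length (false ∷ r))) (sym (carried false r))
        (gain-double (digits-gain r false m m≤pairs))
digits-gain (true ∷ r)      true  m       m≤pairs  =
  subst (λ w → HasGain m w (2 ^ length (true ∷ r))) (sym (carried true r))
        (gain-double (digits-gain r true m m≤pairs))
digits-gain (false ∷ b ∷ r) true  (suc m) (s≤s m≤pairs) =
  subst (λ w → HasGain (suc m) w (2 ^ length (false ∷ b ∷ r))) (+-comm 1 (value (false ∷ b ∷ r)))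
        (gain-after-pair b r (λ c → digits-gain r c m) m≤pairs)
digits-gain (true ∷ b ∷ r)  false (suc m) (s≤s m≤pairs) =
  subst (λ w → HasGain (suc m) w (2 ^ length (true ∷ b ∷ r))) (sym (+-identityʳ (value (true ∷ b ∷ r))))
        (gain-after-pair b r (λ c → digits-gain r c m) m≤pairs)

headBit : List Bool → ℕ
headBit []      = 0
headBit (b ∷ _) = bit b

patterns01 : List Bool → ℕ
patterns01 []          = 0
patterns01 (false ∷ r) = headBit r + patterns01 r
patterns01 (true ∷ r)  = patterns01 r

-- 1 if the word starts with a digit 1 that meets no carry (it will open a mixed pair).
openingOne : List Bool → Bool → ℕ
openingOne (true ∷ _) false = 1
openingOne _          _     = 0

bit≤1 : ∀ b → bit b ≤ 1
bit≤1 false = z≤n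
bit≤1 true  = ≤-refl

patterns01-cons≤ : ∀ b r → patterns01 (b ∷ r) ≤ suc (patterns01 r)
patterns01-cons≤ true  r       = n≤1+n _
patterns01-cons≤ false []      = z≤n
patterns01-cons≤ false (b ∷ r) = +-monoˡ-≤ (patterns01 (b ∷ r)) (bit≤1 b)

openingOne-no-carry : ∀ r → openingOne r false ≡ headBit r
openingOne-no-carry []          = refl
openingOne-no-carry (false ∷ _) = refl
openingOne-no-carry (true ∷ _)  = refl

pair-invariant : ∀ r x → x ≤ 2 + patterns01 r →
  (∀ c → patterns01 r + openingOne r c ≤ suc (2 * mixedPairs r c)) →
  x ≤ suc (2 * suc (mixedPairs r false ⊓ mixedPairs r true))
pair-invariant r x x≤ invariant-r = begin
  x                                                  ≤⟨ x≤ ⟩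
  2 + patterns01 r                                   ≤⟨ +-monoʳ-≤ 2 (bound-by-min (⊓-sel (mixedPairs r false) (mixedPairs r true))) ⟩
  2 + suc (2 * (mixedPairs r false ⊓ mixedPairs r true)) ≡⟨ cong suc (*-suc 2 _) ⟨
  suc (2 * suc (mixedPairs r false ⊓ mixedPairs r true)) ∎
  where
  open ≤-Reasoning
  bound : ∀ c → patterns01 r ≤ suc (2 * mixedPairs r c)
  bound c = ≤-trans (m≤m+n _ _) (invariant-r c)
  bound-by-min : mixedPairs r false ⊓ mixedPairs r true ≡ mixedPairs r false
               ⊎ mixedPairs r false ⊓ mixedPairs r true ≡ mixedPairs r true →
               patterns01 r ≤ suc (2 * (mixedPairs r false ⊓ mixedPairs r true))
  bound-by-min (inj₁ min≡) rewrite min≡ = bound false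
  bound-by-min (inj₂ min≡) rewrite min≡ = bound true

-- Each mixed pair accounts for at most two 01 patterns: #01 + [opening 1] ≤ 2·pairs + 1.
patterns01≤mixedPairs : ∀ as c → patterns01 as + openingOne as c ≤ suc (2 * mixedPairs as c)
patterns01≤mixedPairs []              c     = z≤n
patterns01≤mixedPairs (false ∷ r)     false =
  subst (_≤ suc (2 * mixedPairs r false))
        (trans (cong (_+_ (patterns01 r)) (openingOne-no-carry r)) (trans (+-comm _ (headBit r)) (sym (+-identityʳ _))))
        (patterns01≤mixedPairs r false)
patterns01≤mixedPairs (true ∷ r)      true  =
  ≤-trans (≤-reflexive (+-identityʳ _)) (≤-trans (m≤m+n _ _) (patterns01≤mixedPairs r true))
patterns01≤mixedPairs (false ∷ [])    true  = z≤n
patterns01≤mixedPairs (true ∷ [])     false = s≤s z≤n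
patterns01≤mixedPairs (false ∷ b ∷ r) true  =
  pair-invariant r _ (≤-trans (≤-reflexive (+-identityʳ _)) (+-mono-≤ (bit≤1 b) (patterns01-cons≤ b r)))
                 (patterns01≤mixedPairs r)
patterns01≤mixedPairs (true ∷ b ∷ r)  false =
  pair-invariant r _ (≤-trans (≤-reflexive (+-comm _ 1)) (s≤s (patterns01-cons≤ b r)))
                 (patterns01≤mixedPairs r)

isOdd : ℕ → Bool
isOdd n = ⌊ n % 2 ≟ 1 ⌋

digits : ℕ → ℕ → List Bool
digits zero    n = []
digits (suc f) n = isOdd n ∷ digits f (n / 2)

length-digits : ∀ f n → length (digits f n) ≡ f
length-digits zero    n = refl
length-digits (suc f) n = cong suc (length-digits f (n / 2))

n%2≡0⊎n%2≡1 : ∀ n → n % 2 ≡ 0 ⊎ n % 2 ≡ 1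
n%2≡0⊎n%2≡1 n with n % 2 | m%n<n n 2
... | zero          | _ = inj₁ refl
... | suc zero      | _ = inj₂ refl
... | suc (suc _)   | s≤s (s≤s ())

bit-isOdd : ∀ n → bit (isOdd n) ≡ n % 2
bit-isOdd n with n%2≡0⊎n%2≡1 n
... | inj₁ n%2≡0 = trans (cong (λ r → bit ⌊ r ≟ 1 ⌋) n%2≡0) (sym n%2≡0)
... | inj₂ n%2≡1 = trans (cong (λ r → bit ⌊ r ≟ 1 ⌋) n%2≡1) (sym n%2≡1)

value-digits : ∀ f n → n ≤ f → value (digits f n) ≡ n
value-digits zero    zero    _   = refl
value-digits (suc f) n       n≤f = begin
  bit (isOdd n) + value (digits f (n / 2)) * 2
    ≡⟨ cong₂ (λ r q → r + q * 2) (bit-isOdd n) (value-digits f (n / 2) (n≤1+f⇒n/2≤f n f n≤f)) ⟩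
  n % 2 + (n / 2) * 2
    ≡⟨ m≡m%n+[m/n]*n n 2 ⟨
  n ∎
  where open ≡-Reasoning

l-fuel≡patterns01 : ∀ f n → n ≤ f → l-fuel f n ≡ patterns01 (digits f n)
l-fuel≡patterns01 zero    zero    _   = refl
l-fuel≡patterns01 (suc f) n       n≤f with n%2≡0⊎n%2≡1 n
... | inj₁ n%2≡0 rewrite n%2≡0 =
  cong₂ _+_ (next-digit f (n / 2) (n≤1+f⇒n/2≤f n f n≤f)) (l-fuel≡patterns01 f (n / 2) (n≤1+f⇒n/2≤f n f n≤f))
  where
  next-digit : ∀ f m → m ≤ f → (if ⌊ m % 2 ≟ 1 ⌋ then 1 else 0) ≡ headBit (digits f m)
  next-digit zero    zero _ = refl
  next-digit (suc f) m    _ with isOdd m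
  ... | false = refl
  ... | true  = refl
... | inj₂ n%2≡1 rewrite n%2≡1 = l-fuel≡patterns01 f (n / 2) (n≤1+f⇒n/2≤f n f n≤f)

l≡patterns01 : ∀ a → l a ≡ patterns01 (digits a a)
l≡patterns01 a = l-fuel≡patterns01 a a ≤-refl

gainExponent : ℕ → ℕ
gainExponent a = mixedPairs (digits a a) false

l≤2·gainExponent+1 : ∀ a → l a ≤ suc (2 * gainExponent a)
l≤2·gainExponent+1 a = ≤-trans (≤-reflexive (l≡patterns01 a))
                               (≤-trans (m≤m+n _ _) (patterns01≤mixedPairs (digits a a) false))

roundUp-bounds : ∀ X P .{{_ : NonZero P}} → X ≤ P * suc (X / P) × P * suc (X / P) ≤ X + P
roundUp-bounds X P = lower , upper
  where
  open ≤-Reasoning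
  lower : X ≤ P * suc (X / P)
  lower = begin
    X                    ≡⟨ m≡m%n+[m/n]*n X P ⟩
    X % P + X / P * P    ≤⟨ +-monoˡ-≤ (X / P * P) (<⇒≤ (m%n<n X P)) ⟩
    P + X / P * P        ≡⟨ cong (_+_ P) (*-comm (X / P) P) ⟩
    P + P * (X / P)      ≡⟨ *-suc P (X / P) ⟨
    P * suc (X / P)      ∎
  upper : P * suc (X / P) ≤ X + P
  upper = begin
    P * suc (X / P)      ≡⟨ *-suc P (X / P) ⟩
    P + P * (X / P)      ≡⟨ cong (_+_ P) (*-comm P (X / P)) ⟩
    P + X / P * P        ≤⟨ +-monoʳ-≤ P (m/n*n≤m X P) ⟩
    P + X                ≡⟨ +-comm P X ⟩
    X + P                ∎

foldr-applyUpTo≡sumBelow : ∀ (f : ℕ → ℕ) n → foldr _+_ 0 (applyUpTo f n) ≡ sumBelow f n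
foldr-applyUpTo≡sumBelow f zero    = refl
foldr-applyUpTo≡sumBelow f (suc n) = cong (_+_ (f 0)) (foldr-applyUpTo≡sumBelow (λ x → f (suc x)) n)

indicator≡binomℤ-0 : ∀ u d → (if ⌊ u ℤ.≟ d ⌋ then 1 else 0) ≡ binomℤ 0 (d ℤ.- u)
indicator≡binomℤ-0 u d with u ℤ.≟ d
... | yes refl = sym (cong (binomℤ 0) (ℤₚ.+-inverseʳ u))
... | no  u≢d  = sym (binomℤ-0-off-centre (d ℤ.- u) (λ d-u≡0 → u≢d (sym (ℤₚ.i-j≡0⇒i≡j d u d-u≡0))))

count≡smoothedCount : ∀ a d K → count a d K ≡ smoothedCount 0 a (suc K) d
count≡smoothedCount a d K =
  trans (cong (foldr _+_ 0) (map-upTo indicator (suc K)))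
        (trans (foldr-applyUpTo≡sumBelow indicator (suc K))
               (sumBelow-cong (suc K) (λ x → indicator≡binomℤ-0 (digitDiff a x) d)))
  where
  indicator : ℕ → ℕ
  indicator x = if ⌊ (ℤ.+ s₂ (x + a)) ℤ.- (ℤ.+ s₂ x) ℤ.≟ d ⌋ then 1 else 0

count-bound : ∀ a d K → 4 ^ gainExponent a * count a d K ≤ potential (gainExponent a) 0 * (suc K + 2 ^ a)
count-bound a d K = begin
  4 ^ m * count a d K                                  ≡⟨ cong (4 ^ m *_) (count≡smoothedCount a d K) ⟩
  4 ^ m * smoothedCount 0 a (suc K) d                  ≤⟨ *-monoʳ-≤ (4 ^ m) (sumBelow-monoˡ _ (proj₁ (roundUp-bounds (suc K) P))) ⟩
  4 ^ m * smoothedCount 0 a (P * N) d                  ≡⟨ cong₂ (λ w L → 4 ^ m * smoothedCount 0 w (2 ^ L * N) d)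
                                                                (sym a≡value) (sym (length-digits a a)) ⟩
  4 ^ m * smoothedCount 0 (value as + 0) (2 ^ length as * N) d
                                                       ≤⟨ gain-bound (digits-gain as false m ≤-refl) 0 N d ⟩
  2 ^ length as * (potential m 0 * N)                  ≡⟨ cong (λ L → 2 ^ L * (potential m 0 * N)) (length-digits a a) ⟩
  P * (potential m 0 * N)                              ≡⟨ x∙[y∙z]≡y∙[x∙z] P (potential m 0) N ⟩
  potential m 0 * (P * N)                              ≤⟨ *-monoʳ-≤ (potential m 0) (proj₂ (roundUp-bounds (suc K) P)) ⟩
  potential m 0 * (suc K + P)                          ∎
  where
  open ≤-Reasoning
  m  = gainExponent a
  as = digits a a
  P  = 2 ^ a
  instance P≢0 : NonZero P
  P≢0 = m^n≢0 2 a
  -- the range K + 1 rounded up to the multiple P·N of the scale P = 2^(number of digits)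
  N  = suc (suc K / P)
  a≡value : value as + 0 ≡ a
  a≡value = trans (+-identityʳ _) (value-digits a a ≤-refl)
  x∙[y∙z]≡y∙[x∙z] : ∀ x y z → x * (y * z) ≡ y * (x * z)
  x∙[y∙z]≡y∙[x∙z] = solve-∀

-ᵘ-injective : ∀ i j u → i ℤ.- u ≡ j ℤ.- u → i ≡ j
-ᵘ-injective i j u i-u≡j-u = trans (sym (cancel i u)) (trans (cong (ℤ._+ u) i-u≡j-u) (cancel j u))
  where
  cancel : ∀ i u → (i ℤ.- u) ℤ.+ u ≡ i
  cancel = ℤ-Solver.solve-∀

indicators≤1 : ∀ K (h : ℕ → ℤ) → (∀ i j → h i ≡ h j → i ≡ j) → sumBelow (λ k → binomℤ 0 (h k)) K ≤ 1
indicators≤1 zero    h h-injective = z≤n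
indicators≤1 (suc K) h h-injective with h 0 ℤ.≟ ℤ.+ 0
... | yes h0≡0 = subst (λ z → binomℤ 0 z + sumBelow (λ k → binomℤ 0 (h (suc k))) K ≤ 1) (sym h0≡0)
  (≤-reflexive (cong (_+_ 1) (sumBelow-zero K (λ k → binomℤ-0-off-centre (h (suc k))
    (λ h[1+k]≡0 → 1+n≢0 (h-injective (suc k) 0 (trans h[1+k]≡0 (sym h0≡0))))))))
... | no  h0≢0 = subst (λ z → z + sumBelow (λ k → binomℤ 0 (h (suc k))) K ≤ 1) (sym (binomℤ-0-off-centre (h 0) h0≢0))
  (indicators≤1 K (λ k → h (suc k)) (λ i j h[1+i]≡h[1+j] → suc-injective (h-injective (suc i) (suc j) h[1+i]≡h[1+j])))

-- Each x ≤ N has one value D_a(x), so the counts for distinct values d add up to at most N + 1.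
counts-disjoint : ∀ a N K (d : ℕ → ℤ) → (∀ i j → d i ≡ d j → i ≡ j) → sumBelow (λ k → count a (d k) N) K ≤ suc N
counts-disjoint a N K d d-injective = begin
  sumBelow (λ k → count a (d k) N) K
    ≡⟨ sumBelow-cong K (λ k → count≡smoothedCount a (d k) N) ⟩
  sumBelow (λ k → sumBelow (λ x → binomℤ 0 (d k ℤ.- digitDiff a x)) (suc N)) K
    ≡⟨ sumBelow-swap (λ k x → binomℤ 0 (d k ℤ.- digitDiff a x)) K (suc N) ⟩
  sumBelow (λ x → sumBelow (λ k → binomℤ 0 (d k ℤ.- digitDiff a x)) K) (suc N)
    ≤⟨ sumBelow-≤-const _ 1 (suc N) (λ x → indicators≤1 K (λ k → d k ℤ.- digitDiff a x)
         (λ i j eq → d-injective i j (-ᵘ-injective (d i) (d j) (digitDiff a x) eq))) ⟩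
  suc N * 1
    ≡⟨ *-identityʳ (suc N) ⟩
  suc N ∎
  where open ≤-Reasoning

frac : ℕ → ℕ → ℚ
frac a n = (+ a) ℚ./ suc n

toℚᵘ-frac : ∀ a n → ℚ.toℚᵘ (frac a n) ℚᵘ.≃ ℚᵘ.mkℚᵘ (+ a) n
toℚᵘ-frac a n = ℚₚ.toℚᵘ-fromℚᵘ (ℚᵘ.mkℚᵘ (+ a) n)

frac-≤ : ∀ a n b d → a * suc d ≤ b * suc n → frac a n ℚ.≤ frac b d
frac-≤ a n b d cross = ℚₚ.toℚᵘ-cancel-≤
  (ℚᵘₚ.≤-respʳ-≃ (ℚᵘₚ.≃-sym (toℚᵘ-frac b d)) (ℚᵘₚ.≤-respˡ-≃ (ℚᵘₚ.≃-sym (toℚᵘ-frac a n))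
    (ℚᵘ.*≤* (subst₂ ℤ._≤_ (ℤₚ.pos-* a (suc d)) (ℤₚ.pos-* b (suc n)) (ℤ.+≤+ cross)))))

frac-≤⁻ : ∀ a n b d → frac a n ℚ.≤ frac b d → a * suc d ≤ b * suc n
frac-≤⁻ a n b d a/n≤b/d = ℤₚ.drop‿+≤+ (subst₂ ℤ._≤_ (sym (ℤₚ.pos-* a (suc d))) (sym (ℤₚ.pos-* b (suc n)))
  (ℚᵘₚ.drop-*≤* (ℚᵘₚ.≤-respʳ-≃ (toℚᵘ-frac b d) (ℚᵘₚ.≤-respˡ-≃ (toℚᵘ-frac a n) (ℚₚ.toℚᵘ-mono-≤ a/n≤b/d)))))

frac-nonneg : ∀ a n → 0ℚ ℚ.≤ frac a n
frac-nonneg a n = frac-≤ 0 0 a n z≤n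

frac-antitone : ∀ c {j n} → j ≤ n → frac c n ℚ.≤ frac c j
frac-antitone c j≤n = frac-≤ c _ c _ (*-monoʳ-≤ c (s≤s j≤n))

frac-positive : ∀ j → 0ℚ ℚ.< frac 1 j
frac-positive j = ℚₚ.toℚᵘ-cancel-< (ℚᵘₚ.<-respʳ-≃ (ℚᵘₚ.≃-sym (toℚᵘ-frac 1 j))
  (ℚᵘₚ.<-respˡ-≃ (ℚᵘₚ.≃-sym (toℚᵘ-frac 0 0)) (ℚᵘ.*<* (ℤ.+<+ (s≤s z≤n)))))

frac-+ : ∀ a n b d → frac a n ℚ.+ frac b d ≡ frac (a * suc d + b * suc n) (d + n * suc d)
frac-+ a n b d = ℚₚ.toℚᵘ-injective (ℚᵘₚ.≃-trans (ℚₚ.toℚᵘ-homo-+ (frac a n) (frac b d))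
  (ℚᵘₚ.≃-trans (ℚᵘₚ.+-cong (toℚᵘ-frac a n) (toℚᵘ-frac b d))
  (ℚᵘₚ.≃-trans (ℚᵘ.*≡* cross) (ℚᵘₚ.≃-sym (toℚᵘ-frac (a * suc d + b * suc n) (d + n * suc d))))))
  where
  cross : ((+ a) ℤ.* (+ suc d) ℤ.+ (+ b) ℤ.* (+ suc n)) ℤ.* (+ suc (d + n * suc d))
        ≡ (+ (a * suc d + b * suc n)) ℤ.* (+ (suc n * suc d))
  cross = cong (ℤ._* (+ suc (d + n * suc d)))
    (sym (trans (ℤₚ.pos-+ (a * suc d) (b * suc n)) (cong₂ ℤ._+_ (ℤₚ.pos-* a (suc d)) (ℤₚ.pos-* b (suc n)))))

frac-* : ∀ a n b d → frac a n ℚ.* frac b d ≡ frac (a * b) (d + n * suc d)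
frac-* a n b d = ℚₚ.toℚᵘ-injective (ℚᵘₚ.≃-trans (ℚₚ.toℚᵘ-homo-* (frac a n) (frac b d))
  (ℚᵘₚ.≃-trans (ℚᵘₚ.*-cong (toℚᵘ-frac a n) (toℚᵘ-frac b d))
  (ℚᵘₚ.≃-trans (ℚᵘ.*≡* (cong (ℤ._* (+ suc (d + n * suc d))) (sym (ℤₚ.pos-* a b))))
               (ℚᵘₚ.≃-sym (toℚᵘ-frac (a * b) (d + n * suc d))))))

frac-cong : ∀ a n b d → a * suc d ≡ b * suc n → frac a n ≡ frac b d
frac-cong a n b d cross = ℚₚ.≤-antisym (frac-≤ a n b d (≤-reflexive cross)) (frac-≤ b d a n (≤-reflexive (sym cross)))

frac-+-same : ∀ a b n → frac a n ℚ.+ frac b n ≡ frac (a + b) n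
frac-+-same a b n = trans (frac-+ a n b n) (frac-cong (a * suc n + b * suc n) (n + n * suc n) (a + b) n (common-denominator a b n))
  where
  common-denominator : ∀ a b n → (a * suc n + b * suc n) * suc n ≡ (a + b) * suc (n + n * suc n)
  common-denominator = solve-∀

≤-archimedean : ∀ x y K → (∀ j → x ℚ.≤ y ℚ.+ frac K j) → x ℚ.≤ y
≤-archimedean x y K x≤y+K/j = subst₂ ℚ._≤_ (x-y+y≡x x y) (ℚₚ.+-identityˡ y)
  (ℚₚ.+-monoˡ-≤ y (nonpositive (x ℚ.- y) (λ j →
    subst (x ℚ.- y ℚ.≤_) (y+f-y≡f y (frac K j)) (ℚₚ.+-monoˡ-≤ (ℚ.- y) (x≤y+K/j j)))))
  where
  x-y+y≡x : ∀ x y → (x ℚ.- y) ℚ.+ y ≡ x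
  x-y+y≡x = solve 2 (λ x y → (x :- y) :+ y := x) refl
  y+f-y≡f : ∀ y f → (y ℚ.+ f) ℚ.- y ≡ f
  y+f-y≡f = solve 2 (λ y f → (y :+ f) :- y := f) refl
  -- a positive p/(q+1) exceeds K/(j+1) for j = K(q+1)
  not-positive : ∀ z → 0ℚ ℚ.< z → (∀ j → z ℚ.≤ frac K j) → ⊥
  not-positive (mkℚ (+ zero) q _)  0<z _ = ℤₚ.<-irrefl refl (ℚₚ.drop-*<* 0<z)
  not-positive (mkℚ -[1+ p ] q _)  0<z _ =
    ℤₚ.<-asym (subst₂ ℤ._<_ (ℤₚ.*-zeroˡ (+ suc q)) (ℤₚ.*-identityʳ -[1+ p ]) (ℚₚ.drop-*<* 0<z)) ℤ.-<+
  not-positive z@(mkℚ (+ suc p) q _) _ z≤K/j = <-irrefl refl (≤-trans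
    (m≤m+n (suc j) (p * suc j))
    (frac-≤⁻ (suc p) q K j (subst (ℚ._≤ frac K j) (sym (ℚₚ.↥p/↧p≡p z)) (z≤K/j j))))
    where j = K * suc q
  nonpositive : ∀ z → (∀ j → z ℚ.≤ frac K j) → z ℚ.≤ 0ℚ
  nonpositive z z≤K/j with z ℚₚ.≤? 0ℚ
  ... | yes z≤0 = z≤0
  ... | no  z≰0 = contradiction z≤K/j (not-positive z (ℚₚ.≰⇒> z≰0))

p≤∣p∣ : ∀ p → p ℚ.≤ ℚ.∣ p ∣
p≤∣p∣ p with ℚₚ.∣p∣≡p∨∣p∣≡-p p
... | inj₁ ∣p∣≡p  = ℚₚ.≤-reflexive (sym ∣p∣≡p)
... | inj₂ ∣p∣≡-p = ℚₚ.≤-trans p≤0 (ℚₚ.0≤∣p∣ p)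
  where
  neg-involutive : ∀ p → ℚ.- (ℚ.- p) ≡ p
  neg-involutive = solve 1 (λ p → :- (:- p) := p) refl
  p≤0 : p ℚ.≤ 0ℚ
  p≤0 = subst (ℚ._≤ 0ℚ) (neg-involutive p) (ℚₚ.neg-antimono-≤ (subst (0ℚ ℚ.≤_) ∣p∣≡-p (ℚₚ.0≤∣p∣ p)))

∣f-x∣≤ε⇒x≤f+ε : ∀ f x ε → ℚ.∣ f ℚ.- x ∣ ℚ.≤ ε → x ℚ.≤ f ℚ.+ ε
∣f-x∣≤ε⇒x≤f+ε f x ε ∣f-x∣≤ε = subst (ℚ._≤ f ℚ.+ ε) (f-[f-x]≡x f x)
  (ℚₚ.+-monoʳ-≤ f (ℚₚ.≤-trans (subst (ℚ.- (f ℚ.- x) ℚ.≤_) (ℚₚ.∣-p∣≡∣p∣ (f ℚ.- x)) (p≤∣p∣ (ℚ.- (f ℚ.- x))))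
                              ∣f-x∣≤ε))
  where
  f-[f-x]≡x : ∀ f x → f ℚ.+ ℚ.- (f ℚ.- x) ≡ x
  f-[f-x]≡x = solve 2 (λ f x → f :+ (:- (f :- x)) := x) refl

∣f-x∣≤ε⇒f≤x+ε : ∀ f x ε → ℚ.∣ f ℚ.- x ∣ ℚ.≤ ε → f ℚ.≤ x ℚ.+ ε
∣f-x∣≤ε⇒f≤x+ε f x ε ∣f-x∣≤ε = subst (ℚ._≤ x ℚ.+ ε) (x+[f-x]≡f f x)
  (ℚₚ.+-monoʳ-≤ x (ℚₚ.≤-trans (p≤∣p∣ (f ℚ.- x)) ∣f-x∣≤ε))
  where
  x+[f-x]≡f : ∀ f x → x ℚ.+ (f ℚ.- x) ≡ f
  x+[f-x]≡f = solve 2 (λ f x → x :+ (f :- x) := f) refl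

sumQ : (ℕ → ℚ) → ℕ → ℚ
sumQ f zero    = 0ℚ
sumQ f (suc n) = f 0 ℚ.+ sumQ (λ k → f (suc k)) n

foldr-map-upTo≡sumQ : ∀ (f : ℕ → ℚ) n → foldr ℚ._+_ 0ℚ (map f (upTo n)) ≡ sumQ f n
foldr-map-upTo≡sumQ f n = trans (cong (foldr ℚ._+_ 0ℚ) (map-upTo f n)) (foldr-applyUpTo f n)
  where
  foldr-applyUpTo : ∀ (f : ℕ → ℚ) n → foldr ℚ._+_ 0ℚ (applyUpTo f n) ≡ sumQ f n
  foldr-applyUpTo f zero    = refl
  foldr-applyUpTo f (suc n) = cong (f 0 ℚ.+_) (foldr-applyUpTo (λ k → f (suc k)) n)

sumQ-mono : ∀ {f g : ℕ → ℚ} n → (∀ k → k < n → f k ℚ.≤ g k) → sumQ f n ℚ.≤ sumQ g n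
sumQ-mono zero    f≤g = ℚₚ.≤-refl
sumQ-mono (suc n) f≤g = ℚₚ.+-mono-≤ (f≤g 0 (s≤s z≤n)) (sumQ-mono n (λ k k<n → f≤g (suc k) (s≤s k<n)))

sumQ-+ : ∀ (f g : ℕ → ℚ) n → sumQ (λ k → f k ℚ.+ g k) n ≡ sumQ f n ℚ.+ sumQ g n
sumQ-+ f g zero    = sym (ℚₚ.+-identityˡ 0ℚ)
sumQ-+ f g (suc n) =
  trans (cong ((f 0 ℚ.+ g 0) ℚ.+_) (sumQ-+ (λ k → f (suc k)) (λ k → g (suc k)) n))
        (+-interchangeℚ (f 0) (g 0) (sumQ (λ k → f (suc k)) n) (sumQ (λ k → g (suc k)) n))
  where
  +-interchangeℚ : ∀ a b c d → (a ℚ.+ b) ℚ.+ (c ℚ.+ d) ≡ (a ℚ.+ c) ℚ.+ (b ℚ.+ d)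
  +-interchangeℚ = solve 4 (λ a b c d → (a :+ b) :+ (c :+ d) := (a :+ c) :+ (b :+ d)) refl

sumQ-*ˡ : ∀ r (f : ℕ → ℚ) n → sumQ (λ k → r ℚ.* f k) n ≡ r ℚ.* sumQ f n
sumQ-*ˡ r f zero    = sym (ℚₚ.*-zeroʳ r)
sumQ-*ˡ r f (suc n) = trans (cong (r ℚ.* f 0 ℚ.+_) (sumQ-*ˡ r (λ k → f (suc k)) n))
                            (sym (ℚₚ.*-distribˡ-+ r (f 0) _))

sumQ-nonneg : ∀ (f : ℕ → ℚ) n → (∀ k → 0ℚ ℚ.≤ f k) → 0ℚ ℚ.≤ sumQ f n
sumQ-nonneg f zero    f≥0 = ℚₚ.≤-refl
sumQ-nonneg f (suc n) f≥0 = subst (ℚ._≤ sumQ f (suc n)) (ℚₚ.+-identityˡ 0ℚ)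
  (ℚₚ.+-mono-≤ (f≥0 0) (sumQ-nonneg (λ k → f (suc k)) n (λ k → f≥0 (suc k))))

sumQ-frac : ∀ (c : ℕ → ℕ) n K → sumQ (λ k → frac (c k) n) K ≡ frac (sumBelow c K) n
sumQ-frac c n zero    = sym (ℚₚ.0/n≡0 (suc n))
sumQ-frac c n (suc K) =
  trans (cong (frac (c 0) n ℚ.+_) (sumQ-frac (λ k → c (suc k)) n K)) (frac-+-same (c 0) _ n)

sumQ-frac-const : ∀ c n K → sumQ (λ _ → frac c n) K ≡ frac (K * c) n
sumQ-frac-const c n zero    = sym (ℚₚ.0/n≡0 (suc n))
sumQ-frac-const c n (suc K) = trans (cong (frac c n ℚ.+_) (sumQ-frac-const c n K)) (frac-+-same c (K * c) n)

limit-sum-≤ : ∀ (s : ℕ → ℕ → ℚ) (x : ℕ → ℚ) K y c → (∀ k → IsLimit (s k) (x k)) →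
              (∀ n → sumQ (λ k → s k n) K ℚ.≤ y ℚ.+ frac c n) → sumQ x K ℚ.≤ y
limit-sum-≤ s x K y c s→x sum≤ = ≤-archimedean (sumQ x K) y (c + K * 1) λ j →
  let ε = frac 1 j
      N₀ : ℕ → ℕ
      N₀ k = proj₁ (s→x k ε (frac-positive j))
      n = sumBelow N₀ K + j
      close : ∀ k → k < K → x k ℚ.≤ s k n ℚ.+ ε
      close k k<K = ∣f-x∣≤ε⇒x≤f+ε (s k n) (x k) ε
        (proj₂ (s→x k ε (frac-positive j)) n (≤-trans (term≤sumBelow N₀ K k k<K) (m≤m+n _ j)))
  in begin
    sumQ x K                                        ≤⟨ sumQ-mono K close ⟩
    sumQ (λ k → s k n ℚ.+ ε) K                      ≡⟨ sumQ-+ (λ k → s k n) (λ _ → ε) K ⟩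
    sumQ (λ k → s k n) K ℚ.+ sumQ (λ _ → ε) K       ≤⟨ ℚₚ.+-mono-≤ (sum≤ n) (ℚₚ.≤-reflexive (sumQ-frac-const 1 j K)) ⟩
    (y ℚ.+ frac c n) ℚ.+ frac (K * 1) j             ≤⟨ ℚₚ.+-monoˡ-≤ (frac (K * 1) j) (ℚₚ.+-monoʳ-≤ y (frac-antitone c (m≤n+m j _))) ⟩
    (y ℚ.+ frac c j) ℚ.+ frac (K * 1) j             ≡⟨ ℚₚ.+-assoc y (frac c j) (frac (K * 1) j) ⟩
    y ℚ.+ (frac c j ℚ.+ frac (K * 1) j)             ≡⟨ cong (y ℚ.+_) (frac-+-same c (K * 1) j) ⟩
    y ℚ.+ frac (c + K * 1) j                        ∎
  where open ℚₚ.≤-Reasoning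

limit-≤ : ∀ {s : ℕ → ℚ} {x} y c → IsLimit s x → (∀ n → s n ℚ.≤ y ℚ.+ frac c n) → x ℚ.≤ y
limit-≤ {s} {x} y c s→x s≤ = subst (ℚ._≤ y) (ℚₚ.+-identityʳ x)
  (limit-sum-≤ (λ _ → s) (λ _ → x) 1 y c (λ _ → s→x)
    (λ n → subst (ℚ._≤ y ℚ.+ frac c n) (sym (ℚₚ.+-identityʳ (s n))) (s≤ n)))

limit-nonneg : ∀ {s : ℕ → ℚ} {x} → IsLimit s x → (∀ n → 0ℚ ℚ.≤ s n) → 0ℚ ℚ.≤ x
limit-nonneg {s} {x} s→x s≥0 = ≤-archimedean 0ℚ x 1 λ j →
  let (N₀ , close) = s→x (frac 1 j) (frac-positive j) in
  ℚₚ.≤-trans (s≥0 N₀) (∣f-x∣≤ε⇒f≤x+ε (s N₀) x (frac 1 j) (close N₀ ≤-refl))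

-- The bound β(a) = H(m, 0) / 4^m, m = m(a), on the point masses of μ_a.
massBound : ℕ → ℚ
massBound a = frac (potential (gainExponent a) 0) (pred (4 ^ gainExponent a))

1+pred4^m≡4^m : ∀ m → suc (pred (4 ^ m)) ≡ 4 ^ m
1+pred4^m≡4^m m = suc-pred (4 ^ m) {{m^n≢0 4 m}}

freq≤massBound : ∀ a d n → freq a d n ℚ.≤ massBound a ℚ.+ frac (potential (gainExponent a) 0 * suc (2 ^ a)) n
freq≤massBound a d n = subst (freq a d n ℚ.≤_) (sym (frac-+ H q K n))
  (frac-≤ c n (H * suc n + K * suc q) (n + q * suc n) (begin
    c * (suc q * suc n)                     ≡⟨ regroup c (suc q) (suc n) ⟩
    suc q * c * suc n                       ≤⟨ *-monoˡ-≤ (suc n) count≤ ⟩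
    H * (suc (suc n) + P) * suc n           ≡⟨ cong (_* suc n) (split H n P) ⟩
    (H * suc n + K) * suc n                 ≤⟨ *-monoˡ-≤ (suc n) (+-monoʳ-≤ (H * suc n) (m≤m*n K (suc q))) ⟩
    (H * suc n + K * suc q) * suc n         ∎))
  where
  open ≤-Reasoning
  m = gainExponent a
  H = potential m 0
  q = pred (4 ^ m)
  P = 2 ^ a
  K = H * suc P
  c = count a d (suc n)
  count≤ : suc q * c ≤ H * (suc (suc n) + P)
  count≤ = subst (λ f → f * c ≤ H * (suc (suc n) + P)) (sym (1+pred4^m≡4^m m)) (count-bound a d (suc n))
  regroup : ∀ c q n → c * (q * n) ≡ q * c * n
  regroup = solve-∀
  split : ∀ H n P → H * (suc (suc n) + P) ≡ H * suc n + H * suc P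
  split = solve-∀

offset : ℕ → ℕ → ℤ
offset M k = (+ k) ℤ.- (+ M)

window-freq≤ : ∀ a M n → sumQ (λ k → freq a (offset M k) n) (suc (M + M)) ℚ.≤ frac 1 0 ℚ.+ frac 1 n
window-freq≤ a M n = begin
  sumQ (λ k → freq a (offset M k) n) (suc (M + M))
    ≡⟨ sumQ-frac (λ k → count a (offset M k) (suc n)) n (suc (M + M)) ⟩
  frac (sumBelow (λ k → count a (offset M k) (suc n)) (suc (M + M))) n
    ≤⟨ frac-≤ (sumBelow (λ k → count a (offset M k) (suc n)) (suc (M + M))) n (1 * suc n + 1 * 1) (n + 0 * suc n) cross ⟩
  frac (1 * suc n + 1 * 1) (n + 0 * suc n)
    ≡⟨ frac-+ 1 0 1 n ⟨
  frac 1 0 ℚ.+ frac 1 n ∎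
  where
  open ℚₚ.≤-Reasoning
  offset-injective : ∀ i j → offset M i ≡ offset M j → i ≡ j
  offset-injective i j eq = ℤₚ.+-injective (-ᵘ-injective (+ i) (+ j) (+ M) eq)
  n+2≡1·[n+1]+1·1 : ∀ n → suc (suc n) ≡ 1 * suc n + 1 * 1
  n+2≡1·[n+1]+1·1 = solve-∀
  cross : sumBelow (λ k → count a (offset M k) (suc n)) (suc (M + M)) * suc (n + 0 * suc n)
        ≤ (1 * suc n + 1 * 1) * suc n
  cross = ≤-trans (*-mono-≤ (counts-disjoint a (suc n) (suc (M + M)) (offset M) offset-injective)
                            (≤-reflexive (cong suc (+-identityʳ n))))
                  (≤-reflexive (cong (_* suc n) (n+2≡1·[n+1]+1·1 n)))

-- For a sub-probability vector with entries in [0, β]: Σ x_k² ≤ β Σ x_k ≤ β.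
sum-of-squares≤ : ∀ (x : ℕ → ℚ) β K → 0ℚ ℚ.≤ β → (∀ k → 0ℚ ℚ.≤ x k) → (∀ k → x k ℚ.≤ β) →
                  sumQ x K ℚ.≤ frac 1 0 → sumQ (λ k → x k ℚ.* x k) K ℚ.≤ β
sum-of-squares≤ x β K β≥0 x≥0 x≤β Σx≤1 = begin
  sumQ (λ k → x k ℚ.* x k) K   ≤⟨ sumQ-mono K (λ k _ → ℚₚ.*-monoʳ-≤-nonNeg (x k) {{ℚ.nonNegative (x≥0 k)}} (x≤β k)) ⟩
  sumQ (λ k → β ℚ.* x k) K     ≡⟨ sumQ-*ˡ β x K ⟩
  β ℚ.* sumQ x K               ≤⟨ ℚₚ.*-monoˡ-≤-nonNeg β {{ℚ.nonNegative β≥0}} Σx≤1 ⟩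
  β ℚ.* frac 1 0               ≡⟨ ℚₚ.*-identityʳ β ⟩
  β                            ∎
  where open ℚₚ.≤-Reasoning

square-nonneg : ∀ {p} → 0ℚ ℚ.≤ p → 0ℚ ℚ.≤ p ℚ.* p
square-nonneg {p} p≥0 =
  ℚₚ.nonNegative⁻¹ _ {{ℚₚ.nonNeg*nonNeg⇒nonNeg p {{ℚ.nonNegative p≥0}} p {{ℚ.nonNegative p≥0}}}}

square-mono : ∀ {p q} → 0ℚ ℚ.≤ p → p ℚ.≤ q → p ℚ.* p ℚ.≤ q ℚ.* q
square-mono {p} {q} p≥0 p≤q = ℚₚ.≤-trans (ℚₚ.*-monoʳ-≤-nonNeg p {{ℚ.nonNegative p≥0}} p≤q)
                                          (ℚₚ.*-monoˡ-≤-nonNeg q {{ℚ.nonNegative (ℚₚ.≤-trans p≥0 p≤q)}} p≤q)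

sqSum≡sumQ : ∀ (μ : ℤ → ℚ) M → sqSum μ M ≡ sumQ (λ k → μ (offset M k) ℚ.* μ (offset M k)) (suc (M + M))
sqSum≡sumQ μ M = foldr-map-upTo≡sumQ (λ k → μ (offset M k) ℚ.* μ (offset M k)) (suc (M + M))

-- β(a)² l(a) ≤ 16: from H(m, 0)² (m + 1) ≤ 8·16^m and l(a) ≤ 2m + 1.
massBound²·l≤16 : ∀ a → massBound a ℚ.* massBound a ℚ.* frac (l a) 0 ℚ.≤ frac 16 0
massBound²·l≤16 a = subst (ℚ._≤ frac 16 0)
  (sym (trans (cong (ℚ._* frac (l a) 0) (frac-* H q H q)) (frac-* (H * H) (q + q * suc q) (l a) 0)))
  (frac-≤ (H * H * l a) (0 + (q + q * suc q) * 1) 16 0 (begin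
    H * H * l a * 1                    ≡⟨ *-identityʳ _ ⟩
    H * H * l a                        ≤⟨ *-monoʳ-≤ (H * H) (≤-trans (l≤2·gainExponent+1 a) (n≤1+n _)) ⟩
    H * H * (2 + 2 * m)                ≡⟨ regroup H m ⟩
    2 * (H * H * suc m)                ≤⟨ *-monoʳ-≤ 2 (potential-bound m) ⟩
    2 * (8 * 16 ^ m)                   ≡⟨ *-assoc 2 8 (16 ^ m) ⟨
    16 * 16 ^ m                        ≡⟨ cong (16 *_) 16^m≡[4^m]² ⟩
    16 * (4 ^ m * (4 ^ m * 1))         ≡⟨ cong (λ f → 16 * (f * (f * 1))) (sym (1+pred4^m≡4^m m)) ⟩
    16 * (suc q * (suc q * 1))         ≡⟨ cong (16 *_) (square q) ⟩
    16 * suc (0 + (q + q * suc q) * 1) ∎))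
  where
  open ≤-Reasoning
  m = gainExponent a
  H = potential m 0
  q = pred (4 ^ m)
  16^m≡[4^m]² : 16 ^ m ≡ 4 ^ m * (4 ^ m * 1)
  16^m≡[4^m]² = trans (^-*-assoc 4 2 m) (trans (cong (4 ^_) (*-comm 2 m)) (sym (^-*-assoc 4 m 2)))
  regroup : ∀ H m → H * H * (2 + 2 * m) ≡ 2 * (H * H * suc m)
  regroup = solve-∀
  square : ∀ q → suc q * (suc q * 1) ≡ suc (0 + (q + q * suc q) * 1)
  square = solve-∀

module _ {a} {μ : ℤ → ℚ} (μ-is-μₐ : IsMu a μ) where

  mass≤massBound : ∀ d → μ d ℚ.≤ massBound a
  mass≤massBound d = limit-≤ (massBound a) (potential (gainExponent a) 0 * suc (2 ^ a)) (μ-is-μₐ d) (freq≤massBound a d)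

  mass-nonneg : ∀ d → 0ℚ ℚ.≤ μ d
  mass-nonneg d = limit-nonneg (μ-is-μₐ d) (λ n → frac-nonneg (count a d (suc n)) n)

  window-mass≤1 : ∀ M → sumQ (λ k → μ (offset M k)) (suc (M + M)) ℚ.≤ frac 1 0
  window-mass≤1 M = limit-sum-≤ (λ k n → freq a (offset M k) n) (λ k → μ (offset M k)) (suc (M + M))
                                (frac 1 0) 1 (λ k → μ-is-μₐ (offset M k)) (window-freq≤ a M)

  sqSum≤massBound : ∀ M → sqSum μ M ℚ.≤ massBound a
  sqSum≤massBound M = subst (ℚ._≤ massBound a) (sym (sqSum≡sumQ μ M))
    (sum-of-squares≤ (λ k → μ (offset M k)) (massBound a) (suc (M + M))
      (frac-nonneg (potential (gainExponent a) 0) (pred (4 ^ gainExponent a)))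
      (λ k → mass-nonneg (offset M k)) (λ k → mass≤massBound (offset M k)) (window-mass≤1 M))

  sqSum-nonneg : ∀ M → 0ℚ ℚ.≤ sqSum μ M
  sqSum-nonneg M = subst (0ℚ ℚ.≤_) (sym (sqSum≡sumQ μ M))
    (sumQ-nonneg _ (suc (M + M)) (λ k → square-nonneg (mass-nonneg (offset M k))))

-- The theorem, with C₀ = 2: ‖μ_a‖₂⁴ · l(a) ≤ β(a)² l(a) ≤ 16.
theorem2 : ∃ λ (C : ℚ) → ∀ (a : ℕ) → 1 ≤ a → 1 ≤ l a →
    ∀ (m : ℤ → ℚ) → IsMu a m → ∀ (M : ℕ) →
      (sqSum m M ℚ.* sqSum m M) ℚ.* ((+ l a) ℚ./ 1) ℚ.≤ C
theorem2 = frac 16 0 , λ a _ _ μ μ-is-μₐ M → ℚₚ.≤-trans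
  (ℚₚ.*-monoʳ-≤-nonNeg (frac (l a) 0) {{ℚ.nonNegative (frac-nonneg (l a) 0)}}
    (square-mono (sqSum-nonneg μ-is-μₐ M) (sqSum≤massBound μ-is-μₐ M)))
  (massBound²·l≤16 a)
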